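{- Let $n\ge 1$. Then \[ \sum_{\sigma \in B_{n}}(-1)^{\ell(\sigma)}x_1^{\mathrm{oneg}(\sigma)} x_2^{\mathrm{eneg}(\sigma)} y^{\mathrm{oinv}(\sigma)}z^{\mathrm{ensp}(\sigma)} = \begin{cases} \displaystyle \prod_{i=1}^{n-1}\bigl(1+ (-1)^i y^{\lceil i/2 \rceil}\bigr) \prod_{i=0}^{\lfloor (n-2)/2 \rfloor}(1-x_1 x_2 z^{2i}), & n \text{ even},\\[2mm] \displaystyle (1-x_1 z^{(n-1)/2}) \prod_{i=1}^{n-1}\bigl(1+ (-1)^i y^{\lceil i/2 \rceil}\bigr) \prod_{i=0}^{\lfloor (n-2)/2 \rfloor}(1-x_1 x_2 z^{2i}), & n \text{ odd}. \end{cases} \]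
   Context: $B_n$ is the group of signed permutations of $[n]$ (bijections $\sigma$ of $\{\pm1,\dots,\pm n\}$ with $\sigma(-i)=-\sigma(i)$), in window notation $[\sigma(1),\dots,\sigma(n)]$. Its Coxeter length is $\ell(\sigma)=\mathrm{inv}(\sigma)+\mathrm{nneg}(\sigma)+\mathrm{nsp}(\sigma)$, where $\mathrm{inv}(\sigma)=|\{(i,j):1\le i<j\le n,\ \sigma(i)>\sigma(j)\}|$, $\mathrm{nneg}(\sigma)=|\{i\in[n]:\sigma(i)<0\}|$, $\mathrm{nsp}(\sigma)=|\{(i,j):1\le i<j\le n,\ \sigma(i)+\sigma(j)<0\}|$. Further, $\mathrm{oneg}(\sigma)$ (resp. $\mathrm{eneg}(\sigma)$) is the number of $i\in[n]$ with $\sigma(i)<0$ and $i$ odd (resp. even); $\mathrm{oinv}(\sigma)$ is the number of pairs $i<j$ with $\sigma(i)>\sigma(j)$ and $j-i$ odd; $\mathrm{ensp}(\sigma)$ is the number of pairs $i<j$ with $\sigma(i)+\sigma(j)<0$ and $j-i$ even. Empty products equal $1$. -}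

module Defs where

open import Level using (Level)
open import Data.Bool using (Bool; true; false; if_then_else_)
open import Data.Nat as ℕ using (ℕ; zero; suc; _%_; _/_)
open import Data.Integer as ℤ using (ℤ; +_)
open import Data.List using (List; []; _∷_; map; concatMap; foldr)
open import Relation.Nullary using (does)
open import Algebra.Bundles using (CommutativeRing)

-- Signed permutations of [n] in window notation [σ(1),…,σ(n)],
-- represented as lists of nonzero integers.

insertAll : {A : Set} → A → List A → List (List A)
insertAll x [] = (x ∷ []) ∷ []
insertAll x (y ∷ ys) = (x ∷ y ∷ ys) ∷ map (y ∷_) (insertAll x ys)

perms : ℕ → List (List ℕ)
perms zero = [] ∷ []
perms (suc n) = concatMap (insertAll (suc n)) (perms n)

signings : List ℕ → List (List ℤ)
signings [] = [] ∷ []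
signings (a ∷ r) = concatMap (λ s → ((+ a) ∷ s) ∷ ((ℤ.- (+ a)) ∷ s) ∷ []) (signings r)

B : ℕ → List (List ℤ)
B n = concatMap signings (perms n)

-- Statistics.  Positions are 1-based.

isOdd : ℕ → Bool
isOdd k = does (k % 2 ℕ.≟ 1)

isNeg : ℤ → Bool
isNeg a = does (a ℤ.<? + 0)

count : Bool → ℕ
count true = 1
count false = 0

posCount : (ℕ → ℤ → Bool) → ℕ → List ℤ → ℕ
posCount P p [] = 0
posCount P p (a ∷ r) = count (P p a) ℕ.+ posCount P (suc p) r

-- pairs (i,j), i<j, with P (j - i) σ(i) σ(j)
countFrom : (ℕ → ℤ → ℤ → Bool) → ℕ → ℤ → List ℤ → ℕ
countFrom P d a [] = 0
countFrom P d a (b ∷ r) = count (P d a b) ℕ.+ countFrom P (suc d) a r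

pairCount : (ℕ → ℤ → ℤ → Bool) → List ℤ → ℕ
pairCount P [] = 0
pairCount P (a ∷ r) = countFrom P 1 a r ℕ.+ pairCount P r

inv nneg nsp oneg eneg oinv ensp ℓ : List ℤ → ℕ
inv  = pairCount (λ d a b → does (b ℤ.<? a))
nneg = posCount (λ i a → isNeg a) 1
nsp  = pairCount (λ d a b → isNeg (a ℤ.+ b))
oneg = posCount (λ i a → if isOdd i then isNeg a else false) 1
eneg = posCount (λ i a → if isOdd i then false else isNeg a) 1
oinv = pairCount (λ d a b → if isOdd d then does (b ℤ.<? a) else false)
ensp = pairCount (λ d a b → if isOdd d then false else isNeg (a ℤ.+ b))
ℓ σ = inv σ ℕ.+ nneg σ ℕ.+ nsp σ

module _ {c ℓ′ : Level} (R : CommutativeRing c ℓ′) where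
  open CommutativeRing R

  pow : Carrier → ℕ → Carrier
  pow x zero = 1#
  pow x (suc k) = x * pow x k

  sgn : ℕ → Carrier
  sgn k = pow (- 1#) k

  sumL : List Carrier → Carrier
  sumL = foldr _+_ 0#

  prodFrom : ℕ → ℕ → (ℕ → Carrier) → Carrier
  prodFrom a zero f = 1#
  prodFrom a (suc k) f = f a * prodFrom (suc a) k f

  lhs : ℕ → Carrier → Carrier → Carrier → Carrier → Carrier
  lhs n x₁ x₂ y z = sumL (map (λ σ → sgn (ℓ σ) * pow x₁ (oneg σ) * pow x₂ (eneg σ)
                                         * pow y (oinv σ) * pow z (ensp σ)) (B n))

  -- ∏_{i=1}^{n-1} (1 + (-1)^i y^{⌈i/2⌉}) · ∏_{i=0}^{⌊(n-2)/2⌋} (1 - x₁ x₂ z^{2i})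
  -- For n ≥ 1 the second product has exactly ⌊n/2⌋ factors (i = 0 … ⌊n/2⌋-1).
  commonProd : ℕ → Carrier → Carrier → Carrier → Carrier → Carrier
  commonProd n x₁ x₂ y z =
    prodFrom 1 (n ℕ.∸ 1) (λ i → 1# + sgn i * pow y ((suc i) / 2))
    * prodFrom 0 (n / 2) (λ i → 1# - x₁ * x₂ * pow z (2 ℕ.* i))

module Submission where

open import Defs
open import Level using (Level)
open import Data.Nat using (ℕ; _≤_; _%_; _/_; _∸_)
open import Data.Product using (_×_)
open import Relation.Binary.PropositionalEquality using (_≡_)
open import Algebra.Bundles using (CommutativeRing)
open import Data.Nat using (suc; _≟_)
open import Data.Product using (_,_; proj₁; proj₂)
open import Relation.Binary.PropositionalEquality using (cong)
open import Relation.Nullary using (does)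

-- Every σ ∈ B (n+1) arises exactly once by inserting ±(n+1) at one of the
-- positions 0, …, n of a signed permutation of [n].  As ±(n+1) dominates all
-- other letters, the effect on every statistic is explicit:
--  * in front, all positions of σ shift by one, so x₁ and x₂ exchange roles;
--  * at the end, the statistics of σ are kept and a fixed monomial is added;
--  * strictly inside, exchanging the two neighbours of ±(n+1) creates one more
--    inversion and changes nothing else, a sign-reversing involution, so these
--    words cancel.  The exchange is a swap of adjacent positions of σ, which
--    permutes B n.
-- This gives a recurrence for the generating function of B (n+1) in terms of
-- that of B n with x₁, x₂ kept and exchanged, solved by induction on n.

module Parity where

  open import Data.Nat using (ℕ; zero; suc; _+_; _*_; _/_; _%_; s≤s; z≤n)
  import Data.Nat as ℕ
  import Data.Nat.Properties as ℕₚ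
  import Data.Nat.DivMod as ℕ÷
  open import Data.Bool using (Bool; true; false; not; if_then_else_)
  open import Relation.Binary.PropositionalEquality
    using (_≡_; refl; sym; trans; cong; cong₂; module ≡-Reasoning)
  open import Relation.Nullary using (does)
  open ≡-Reasoning

  isOdd-+2 : ∀ d → isOdd (2 + d) ≡ isOdd d
  isOdd-+2 d = cong (λ r → does (r ℕ.≟ 1))
    (trans (cong (_% 2) (ℕₚ.+-comm 2 d)) (ℕ÷.[m+kn]%n≡m%n d 1 2))

  isOdd-suc : ∀ d → isOdd (suc d) ≡ not (isOdd d)
  isOdd-suc zero = refl
  isOdd-suc (suc zero) = refl
  isOdd-suc (suc (suc d)) =
    trans (isOdd-+2 (suc d)) (trans (isOdd-suc d) (cong not (sym (isOdd-+2 d))))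

  half-+2 : ∀ m → (2 + m) / 2 ≡ suc (m / 2)
  half-+2 m = ℕ÷.m/n≡1+[m∸n]/n {2 + m} {2} (s≤s (s≤s z≤n))

  half-suc-odd : ∀ n → isOdd n ≡ true → suc n / 2 ≡ suc (n / 2)
  half-suc-odd (suc zero) _ = refl
  half-suc-odd (suc (suc m)) odd = begin
    (2 + suc m) / 2      ≡⟨ half-+2 (suc m) ⟩
    suc (suc m / 2)      ≡⟨ cong suc (half-suc-odd m (trans (sym (isOdd-+2 m)) odd)) ⟩
    suc (suc (m / 2))    ≡⟨ cong suc (sym (half-+2 m)) ⟩
    suc ((2 + m) / 2)    ∎

  half-suc-even : ∀ n → isOdd n ≡ false → suc n / 2 ≡ n / 2
  half-suc-even zero _ = refl
  half-suc-even (suc (suc m)) even = begin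
    (2 + suc m) / 2      ≡⟨ half-+2 (suc m) ⟩
    suc (suc m / 2)      ≡⟨ cong suc (half-suc-even m (trans (sym (isOdd-+2 m)) even)) ⟩
    suc (m / 2)          ≡⟨ sym (half-+2 m) ⟩
    (2 + m) / 2          ∎

  countRange : (ℕ → Bool) → ℕ → ℕ → ℕ
  countRange Q d zero = 0
  countRange Q d (suc N) = count (Q d) + countRange Q (suc d) N

  countRange-const : ∀ b d N → countRange (λ _ → b) d N ≡ count b * N
  countRange-const b d zero = sym (ℕₚ.*-zeroʳ (count b))
  countRange-const b d (suc N) =
    trans (cong (count b +_) (countRange-const b (suc d) N)) (sym (ℕₚ.*-suc (count b) N))

  countRange-snoc : ∀ Q d N → countRange Q d (suc N) ≡ countRange Q d N + count (Q (d + N))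
  countRange-snoc Q d zero = trans (ℕₚ.+-identityʳ _) (cong (λ e → count (Q e)) (sym (ℕₚ.+-identityʳ d)))
  countRange-snoc Q d (suc N) = begin
    count (Q d) + countRange Q (suc d) (suc N)
      ≡⟨ cong (count (Q d) +_) (countRange-snoc Q (suc d) N) ⟩
    count (Q d) + (countRange Q (suc d) N + count (Q (suc d + N)))
      ≡⟨ sym (ℕₚ.+-assoc (count (Q d)) _ _) ⟩
    count (Q d) + countRange Q (suc d) N + count (Q (suc d + N))
      ≡⟨ cong (λ e → count (Q d) + countRange Q (suc d) N + count (Q e)) (sym (ℕₚ.+-suc d N)) ⟩
    count (Q d) + countRange Q (suc d) N + count (Q (d + suc N)) ∎

  countRange-periodic : ∀ Q → (∀ e → Q (2 + e) ≡ Q e) → ∀ d N →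
    countRange Q (2 + d) N ≡ countRange Q d N
  countRange-periodic Q per d zero = refl
  countRange-periodic Q per d (suc N) =
    cong₂ _+_ (cong count (per d)) (countRange-periodic Q per (suc d) N)

  countRange-odd : ∀ s N → countRange (λ e → if isOdd e then s else false) 1 N ≡ count s * ((1 + N) / 2)
  countRange-odd s zero = sym (ℕₚ.*-zeroʳ (count s))
  countRange-odd s (suc zero) = trans (ℕₚ.+-identityʳ (count s)) (sym (ℕₚ.*-identityʳ (count s)))
  countRange-odd s (suc (suc N)) = begin
    count s + countRange Q 3 N
      ≡⟨ cong (count s +_) (trans (countRange-periodic Q Q-per 1 N) (countRange-odd s N)) ⟩
    count s + count s * ((1 + N) / 2)  ≡⟨ sym (ℕₚ.*-suc (count s) _) ⟩
    count s * suc ((1 + N) / 2)        ≡⟨ cong (count s *_) (sym (half-+2 (1 + N))) ⟩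
    count s * ((3 + N) / 2)            ∎
    where
    Q : ℕ → Bool
    Q e = if isOdd e then s else false
    Q-per : ∀ e → Q (2 + e) ≡ Q e
    Q-per e = cong (λ t → if t then s else false) (isOdd-+2 e)

  countRange-even : ∀ s N → countRange (λ e → if isOdd e then false else s) 1 N ≡ count s * (N / 2)
  countRange-even s zero = sym (ℕₚ.*-zeroʳ (count s))
  countRange-even s (suc zero) = sym (ℕₚ.*-zeroʳ (count s))
  countRange-even s (suc (suc N)) = begin
    count s + countRange Q 3 N
      ≡⟨ cong (count s +_) (trans (countRange-periodic Q Q-per 1 N) (countRange-even s N)) ⟩
    count s + count s * (N / 2)  ≡⟨ sym (ℕₚ.*-suc (count s) _) ⟩
    count s * suc (N / 2)        ≡⟨ cong (count s *_) (sym (half-+2 N)) ⟩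
    count s * ((2 + N) / 2)      ∎
    where
    Q : ℕ → Bool
    Q e = if isOdd e then false else s
    Q-per : ∀ e → Q (2 + e) ≡ Q e
    Q-per e = cong (λ t → if t then false else s) (isOdd-+2 e)

module Lists where

  open import Data.Nat using (ℕ; zero; suc; _+_; _≤_; s≤s)
  open import Data.List using (List; []; _∷_; _++_; length)
  open import Data.List.Relation.Unary.All using (All; []; _∷_)
  open import Data.List.Relation.Unary.AllPairs using (AllPairs; []; _∷_)
  open import Data.Product using (_×_; _,_)
  open import Relation.Binary.PropositionalEquality using (_≡_; refl; cong)

  private variable A : Set

  -- insertAt k a xs puts a at (0-based) position k; past the end it appends.
  insertAt : ℕ → A → List A → List A
  insertAt zero a xs = a ∷ xs
  insertAt (suc k) a [] = a ∷ []
  insertAt (suc k) a (x ∷ xs) = x ∷ insertAt k a xs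

  swapAt : ℕ → List A → List A
  swapAt zero (x ∷ y ∷ r) = y ∷ x ∷ r
  swapAt zero xs = xs
  swapAt (suc j) [] = []
  swapAt (suc j) (x ∷ r) = x ∷ swapAt j r

  swapAt-[] : ∀ j → swapAt {A} j [] ≡ []
  swapAt-[] zero = refl
  swapAt-[] (suc j) = refl

  swapAt-short : ∀ j (xs : List A) → length xs ≤ suc j → swapAt j xs ≡ xs
  swapAt-short zero [] _ = refl
  swapAt-short zero (x ∷ []) _ = refl
  swapAt-short zero (x ∷ y ∷ r) (s≤s ())
  swapAt-short (suc j) [] _ = refl
  swapAt-short (suc j) (x ∷ r) (s≤s h) = cong (x ∷_) (swapAt-short j r h)

  length-insertAt : ∀ k (a : A) xs → length (insertAt k a xs) ≡ suc (length xs)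
  length-insertAt zero a xs = refl
  length-insertAt (suc k) a [] = refl
  length-insertAt (suc k) a (x ∷ xs) = cong suc (length-insertAt k a xs)

  swapAt-insertAt-before : ∀ j k (a : A) σ → k ≤ j →
    swapAt (suc j) (insertAt k a σ) ≡ insertAt k a (swapAt j σ)
  swapAt-insertAt-before j zero a σ _ = refl
  swapAt-insertAt-before (suc j) (suc k) a [] _ = refl
  swapAt-insertAt-before (suc j) (suc k) a (x ∷ σ) (s≤s h) =
    cong (x ∷_) (swapAt-insertAt-before j k a σ h)

  swapAt-insertAt-at : ∀ j (a : A) σ → suc j ≤ length σ →
    swapAt j (insertAt j a σ) ≡ insertAt (suc j) a σ
  swapAt-insertAt-at zero a (x ∷ σ) _ = refl
  swapAt-insertAt-at (suc j) a (x ∷ σ) (s≤s h) = cong (x ∷_) (swapAt-insertAt-at j a σ h)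

  swapAt-insertAt-next : ∀ j (a : A) σ → suc j ≤ length σ →
    swapAt j (insertAt (suc j) a σ) ≡ insertAt j a σ
  swapAt-insertAt-next zero a (x ∷ σ) _ = refl
  swapAt-insertAt-next (suc j) a (x ∷ σ) (s≤s h) = cong (x ∷_) (swapAt-insertAt-next j a σ h)

  swapAt-insertAt-after : ∀ j t (a : A) σ → j + suc (suc t) ≤ length σ →
    swapAt j (insertAt (j + suc (suc t)) a σ) ≡ insertAt (j + suc (suc t)) a (swapAt j σ)
  swapAt-insertAt-after zero t a (x ∷ y ∷ σ) _ = refl
  swapAt-insertAt-after zero t a (x ∷ []) (s≤s ())
  swapAt-insertAt-after (suc j) t a (x ∷ σ) (s≤s h) = cong (x ∷_) (swapAt-insertAt-after j t a σ h)

  insertAt-end : ∀ (a : A) σ → insertAt (length σ) a σ ≡ σ ++ a ∷ []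
  insertAt-end a [] = refl
  insertAt-end a (x ∷ σ) = cong (x ∷_) (insertAt-end a σ)

  insertAt-between : ∀ pre (x a y : A) post →
    insertAt (suc (length pre)) a (pre ++ x ∷ y ∷ post) ≡ pre ++ x ∷ a ∷ y ∷ post
  insertAt-between [] x a y post = refl
  insertAt-between (q ∷ pre) x a y post = cong (q ∷_) (insertAt-between pre x a y post)

  swapAt-between : ∀ pre (x y : A) post →
    swapAt (length pre) (pre ++ x ∷ y ∷ post) ≡ pre ++ y ∷ x ∷ post
  swapAt-between [] x y post = refl
  swapAt-between (q ∷ pre) x y post = cong (q ∷_) (swapAt-between pre x y post)

  record AdjacentAt (k : ℕ) (σ : List A) : Set where
    constructor adjacentAt
    field
      pre : List A
      x y : A
      post : List A
      σ-split : σ ≡ pre ++ x ∷ y ∷ post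
      pre-length : length pre ≡ k

  splitAdjacent : ∀ k (σ : List A) → suc (suc k) ≤ length σ → AdjacentAt k σ
  splitAdjacent zero (x ∷ y ∷ σ) _ = adjacentAt [] x y σ refl refl
  splitAdjacent zero (x ∷ []) (s≤s ())
  splitAdjacent (suc k) (q ∷ σ) (s≤s h) with splitAdjacent k σ h
  ... | adjacentAt pre x y post e l = adjacentAt (q ∷ pre) x y post (cong (q ∷_) e) (cong suc l)

  All-adjacent : ∀ {P : A → Set} pre u v post → All P (pre ++ u ∷ v ∷ post) → P u × P v
  All-adjacent [] u v post (pu ∷ pv ∷ _) = pu , pv
  All-adjacent (q ∷ pre) u v post (_ ∷ ps) = All-adjacent pre u v post ps

  AllPairs-adjacent : ∀ {R : A → A → Set} pre u v post → AllPairs R (pre ++ u ∷ v ∷ post) → R u v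
  AllPairs-adjacent [] u v post ((ruv ∷ _) ∷ _) = ruv
  AllPairs-adjacent (q ∷ pre) u v post (_ ∷ rs) = AllPairs-adjacent pre u v post rs

module SignedPermutations where

  open import Data.Nat using (ℕ; zero; suc; _≤_; s≤s)
  import Data.Nat.Properties as ℕₚ
  open import Data.Integer as ℤ using (ℤ; +_; -[1+_]; ∣_∣)
  import Data.Integer.Properties as ℤₚ
  open import Data.Bool using (Bool; true; false; not)
  open import Data.List using (List; []; _∷_; _++_; length; map)
  import Data.List.Properties as Listₚ
  open import Data.List.Relation.Unary.All as All using (All; []; _∷_)
  import Data.List.Relation.Unary.All.Properties as Allₚ
  open import Data.List.Relation.Unary.AllPairs as AllPairs using (AllPairs; []; _∷_)
  import Data.List.Relation.Unary.AllPairs.Properties as AllPairsₚ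
  open import Data.Product using (_×_; _,_)
  open import Data.Empty using (⊥-elim)
  open import Relation.Binary.PropositionalEquality using (_≡_; _≢_; refl; sym; trans; cong; cong₂; subst)
  open import Relation.Binary.Definitions using (tri<; tri≈; tri>)
  open import Relation.Nullary using (does)
  open import Relation.Nullary.Decidable using (dec-true; dec-false)

  SignedPerm : ℕ → List ℤ → Set
  SignedPerm n σ = length σ ≡ n × All (λ v → ∣ v ∣ ≤ n) σ × AllPairs _≢_ σ

  Perm : ℕ → List ℕ → Set
  Perm n p = length p ≡ n × All (_≤ n) p × AllPairs _≢_ p

  private
    insertAll-All : ∀ {P : ℕ → Set} (x : ℕ) p → P x → All P p → All (All P) (insertAll x p)
    insertAll-All x [] px [] = (px ∷ []) ∷ []
    insertAll-All x (y ∷ ys) px (py ∷ ps) =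
      (px ∷ py ∷ ps) ∷ Allₚ.map⁺ (All.map (py ∷_) (insertAll-All x ys px ps))

    insertAll-length : ∀ (x : ℕ) p → All (λ q → length q ≡ suc (length p)) (insertAll x p)
    insertAll-length x [] = refl ∷ []
    insertAll-length x (y ∷ ys) = refl ∷ Allₚ.map⁺ (All.map (cong suc) (insertAll-length x ys))

    insertAll-distinct : ∀ (x : ℕ) p → All (x ≢_) p → AllPairs _≢_ p → All (AllPairs _≢_) (insertAll x p)
    insertAll-distinct x [] _ _ = ([] ∷ []) ∷ []
    insertAll-distinct x (y ∷ ys) (x≢y ∷ x≢ys) (y≢ys ∷ ys-distinct) =
      ((x≢y ∷ x≢ys) ∷ y≢ys ∷ ys-distinct) ∷
      Allₚ.map⁺ (All.zipWith (λ (y≢q , q-distinct) → y≢q ∷ q-distinct)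
        (insertAll-All {P = y ≢_} x ys (λ e → x≢y (sym e)) y≢ys , insertAll-distinct x ys x≢ys ys-distinct))

    insertAll-perm : ∀ n p → Perm n p → All (Perm (suc n)) (insertAll (suc n) p)
    insertAll-perm n p (len , bounded , distinct) =
      All.zipWith (λ (l , (b , d)) → trans l (cong suc len) , b , d)
        (insertAll-length (suc n) p ,
         All.zip
           (insertAll-All {P = _≤ suc n} (suc n) p ℕₚ.≤-refl (All.map ℕₚ.m≤n⇒m≤1+n bounded) ,
            insertAll-distinct (suc n) p
              (All.map (λ v≤n e → ℕₚ.1+n≰n (subst (_≤ n) (sym e) v≤n)) bounded) distinct))

  perms-perm : ∀ n → All (Perm n) (perms n)
  perms-perm zero = (refl , [] , []) ∷ []
  perms-perm (suc n) = Allₚ.concat⁺ (Allₚ.map⁺ (All.map (insertAll-perm n _) (perms-perm n)))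

  private
    signings-abs : ∀ p → All (λ s → map ∣_∣ s ≡ p) (signings p)
    signings-abs [] = refl ∷ []
    signings-abs (a ∷ r) = Allₚ.concat⁺ (Allₚ.map⁺
      (All.map (λ h → cong (a ∷_) h ∷ cong₂ _∷_ (abs-neg a) h ∷ []) (signings-abs r)))
      where
      abs-neg : ∀ a → ∣ ℤ.- (+ a) ∣ ≡ a
      abs-neg zero = refl
      abs-neg (suc a) = refl

    signing-perm : ∀ n s p → map ∣_∣ s ≡ p → Perm n p → SignedPerm n s
    signing-perm n s p refl (len , bounded , distinct) =
      trans (sym (Listₚ.length-map ∣_∣ s)) len ,
      Allₚ.map⁻ bounded ,
      AllPairs.map (λ ne e → ne (cong ∣_∣ e)) (AllPairsₚ.map⁻ distinct)

  B-signedPerm : ∀ n → All (SignedPerm n) (B n)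
  B-signedPerm n = Allₚ.concat⁺ (Allₚ.map⁺ (All.map
    (λ {p} perm → All.map (λ {s} e → signing-perm n s p e perm) (signings-abs p)) (perms-perm n)))

  ascentAt : ℕ → List ℤ → Bool
  ascentAt zero (x ∷ y ∷ r) = does (x ℤ.<? y)
  ascentAt zero _ = false
  ascentAt (suc j) [] = false
  ascentAt (suc j) (_ ∷ r) = ascentAt j r

  ascentAt-between : ∀ pre x y post → ascentAt (length pre) (pre ++ x ∷ y ∷ post) ≡ does (x ℤ.<? y)
  ascentAt-between [] x y post = refl
  ascentAt-between (q ∷ pre) x y post = ascentAt-between pre x y post

  <-flip : ∀ x y → x ≢ y → does (y ℤ.<? x) ≡ not (does (x ℤ.<? y))
  <-flip x y x≢y with ℤₚ.<-cmp x y
  ... | tri< x<y _ y≮x rewrite dec-true (x ℤ.<? y) x<y | dec-false (y ℤ.<? x) y≮x = refl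
  ... | tri≈ _ x≡y _ = ⊥-elim (x≢y x≡y)
  ... | tri> x≮y _ y<x rewrite dec-false (x ℤ.<? y) x≮y | dec-true (y ℤ.<? x) y<x = refl

  -- A letter a dominating every entry v with |v| ≤ n: all comparisons with a
  -- and all signs of sums involving a are fixed by the flag s (true for n+1,
  -- false for -(n+1)).
  record Dominant (n : ℕ) (a : ℤ) (s : Bool) : Set where
    field
      below : ∀ v → ∣ v ∣ ≤ n → does (v ℤ.<? a) ≡ s
      above : ∀ v → ∣ v ∣ ≤ n → does (a ℤ.<? v) ≡ not s
      sumˡ : ∀ v → ∣ v ∣ ≤ n → isNeg (a ℤ.+ v) ≡ not s
      sumʳ : ∀ v → ∣ v ∣ ≤ n → isNeg (v ℤ.+ a) ≡ not s
      sign : isNeg a ≡ not s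

  dominant-pos : ∀ n → Dominant n (+ suc n) true
  dominant-pos n = record { below = below ; above = above ; sumˡ = sumˡ ; sumʳ = sumʳ ; sign = refl }
    where
    below : ∀ v → ∣ v ∣ ≤ n → does (v ℤ.<? + suc n) ≡ true
    below (+ k) h = dec-true (+ k ℤ.<? + suc n) (ℤ.+<+ (s≤s h))
    below -[1+ k ] h = dec-true (-[1+ k ] ℤ.<? + suc n) ℤ.-<+
    above : ∀ v → ∣ v ∣ ≤ n → does (+ suc n ℤ.<? v) ≡ false
    above (+ k) h = dec-false (+ suc n ℤ.<? + k)
      (λ { (ℤ.+<+ n<k) → ℕₚ.≤⇒≯ h (ℕₚ.<-trans (ℕₚ.n<1+n n) n<k) })
    above -[1+ k ] h = dec-false (+ suc n ℤ.<? -[1+ k ]) (λ ())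
    sumˡ : ∀ v → ∣ v ∣ ≤ n → isNeg (+ suc n ℤ.+ v) ≡ false
    sumˡ (+ k) h = refl
    sumˡ -[1+ k ] h rewrite ℤₚ.⊖-≥ {suc n} {suc k} (ℕₚ.m≤n⇒m≤1+n h) = refl
    sumʳ : ∀ v → ∣ v ∣ ≤ n → isNeg (v ℤ.+ + suc n) ≡ false
    sumʳ v h rewrite ℤₚ.+-comm v (+ suc n) = sumˡ v h

  dominant-neg : ∀ n → Dominant n -[1+ n ] false
  dominant-neg n = record { below = below ; above = above ; sumˡ = sumˡ ; sumʳ = sumʳ ; sign = refl }
    where
    below : ∀ v → ∣ v ∣ ≤ n → does (v ℤ.<? -[1+ n ]) ≡ false
    below (+ k) h = dec-false (+ k ℤ.<? -[1+ n ]) (λ ())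
    below -[1+ k ] h = dec-false (-[1+ k ] ℤ.<? -[1+ n ]) (λ { (ℤ.-<- n<k) → ℕₚ.<-asym n<k h })
    above : ∀ v → ∣ v ∣ ≤ n → does (-[1+ n ] ℤ.<? v) ≡ true
    above (+ k) h = dec-true (-[1+ n ] ℤ.<? + k) ℤ.-<+
    above -[1+ k ] h = dec-true (-[1+ n ] ℤ.<? -[1+ k ]) (ℤ.-<- h)
    sumˡ : ∀ v → ∣ v ∣ ≤ n → isNeg (-[1+ n ] ℤ.+ v) ≡ true
    sumˡ (+ k) h rewrite ℤₚ.⊖-< {k} {suc n} (s≤s h) | ℕₚ.+-∸-assoc 1 h = refl
    sumˡ -[1+ k ] h = refl
    sumʳ : ∀ v → ∣ v ∣ ≤ n → isNeg (v ℤ.+ -[1+ n ]) ≡ true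
    sumʳ v h rewrite ℤₚ.+-comm v (-[1+ n ]) = sumˡ v h

module Statistics where

  open Parity
  open Lists
  open SignedPermutations
  open import Data.Nat using (ℕ; suc; _+_; _*_; _≤_; _/_)
  import Data.Nat.Properties as ℕₚ
  open import Data.Nat.Tactic.RingSolver using (solve-∀)
  open import Data.Integer as ℤ using (ℤ; ∣_∣)
  import Data.Integer.Properties as ℤₚ
  open import Data.Bool using (Bool; true; false; not; if_then_else_)
  open import Data.List using (List; []; _∷_; _++_; length)
  open import Data.List.Relation.Unary.All as All using (All; []; _∷_)
  open import Relation.Binary.PropositionalEquality
    using (_≡_; refl; sym; trans; cong; cong₂; module ≡-Reasoning)
  open import Relation.Nullary using (does)
  open ≡-Reasoning

  data Exps : Set where
    exps : (len oneg′ eneg′ oinv′ ensp′ : ℕ) → Exps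

  statsOf : List ℤ → Exps
  statsOf σ = exps (ℓ σ) (oneg σ) (eneg σ) (oinv σ) (ensp σ)

  infixl 6 _⊕_
  _⊕_ : Exps → Exps → Exps
  exps a b c d e ⊕ exps a′ b′ c′ d′ e′ = exps (a + a′) (b + b′) (c + c′) (d + d′) (e + e′)

  swapParity : Exps → Exps
  swapParity (exps a b c d e) = exps a c b d e

  lengthen : Exps → Exps
  lengthen (exps a b c d e) = exps (suc a) b c d e

  exps-≡ : ∀ {a a′ b b′ c c′ d d′ e e′} → a ≡ a′ → b ≡ b′ → c ≡ c′ → d ≡ d′ → e ≡ e′ →
    exps a b c d e ≡ exps a′ b′ c′ d′ e′
  exps-≡ refl refl refl refl refl = refl

  PairPred PosPred : Set
  PairPred = ℕ → ℤ → ℤ → Bool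
  PosPred = ℕ → ℤ → Bool

  Periodic₂ : PairPred → Set
  Periodic₂ P = ∀ d a b → P (2 + d) a b ≡ P d a b

  PosPeriodic₂ : PosPred → Set
  PosPeriodic₂ Q = ∀ i v → Q (2 + i) v ≡ Q i v

  -- Exchange of x and y around a.  Only the pairs inside the window x a y
  -- see a different distance parity; everything else is unchanged.
  windowPairs : PairPred → ℤ → ℤ → ℤ → ℕ
  windowPairs P x a y = count (P 1 x a) + count (P 1 a y) + count (P 2 x y)

  countFrom-+2 : ∀ P → Periodic₂ P → ∀ d a σ → countFrom P (2 + d) a σ ≡ countFrom P d a σ
  countFrom-+2 P per d a [] = refl
  countFrom-+2 P per d a (b ∷ σ) = cong₂ _+_ (cong count (per d a b)) (countFrom-+2 P per (suc d) a σ)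

  countFrom-exchange : ∀ P → Periodic₂ P → ∀ pre d p x a y post →
    countFrom P d p (pre ++ x ∷ a ∷ y ∷ post) ≡ countFrom P d p (pre ++ y ∷ a ∷ x ∷ post)
  countFrom-exchange P per [] d p x a y post rewrite per d p y | per d p x =
    reorder (count (P d p x)) (count (P (suc d) p a)) (count (P d p y)) _
    where
    reorder : ∀ X A Y R → X + (A + (Y + R)) ≡ Y + (A + (X + R))
    reorder = solve-∀
  countFrom-exchange P per (q ∷ pre) d p x a y post =
    cong (count (P d p q) +_) (countFrom-exchange P per pre (suc d) p x a y post)

  pairCount-exchange : ∀ P → Periodic₂ P → ∀ pre x a y post →
    pairCount P (pre ++ x ∷ a ∷ y ∷ post) + windowPairs P y a x
    ≡ pairCount P (pre ++ y ∷ a ∷ x ∷ post) + windowPairs P x a y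
  pairCount-exchange P per [] x a y post
    rewrite countFrom-+2 P per 1 x post | countFrom-+2 P per 1 y post =
    reorder (count (P 1 x a)) (count (P 2 x y)) (countFrom P 1 x post) (count (P 1 a y))
            (countFrom P 2 a post) (countFrom P 1 y post) (pairCount P post)
            (count (P 1 y a)) (count (P 2 y x)) (count (P 1 a x))
    where
    reorder : ∀ Pxa Pxy X Pay A Y R Pya Pyx Pax →
      (Pxa + (Pxy + X)) + ((Pay + A) + (Y + R)) + (Pya + Pax + Pyx)
      ≡ (Pya + (Pyx + Y)) + ((Pax + A) + (X + R)) + (Pxa + Pay + Pxy)
    reorder = solve-∀
  pairCount-exchange P per (q ∷ pre) x a y post = begin
    (countFrom P 1 q (pre ++ L) + pairCount P (pre ++ L)) + windowPairs P y a x
      ≡⟨ ℕₚ.+-assoc (countFrom P 1 q (pre ++ L)) _ _ ⟩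
    countFrom P 1 q (pre ++ L) + (pairCount P (pre ++ L) + windowPairs P y a x)
      ≡⟨ cong₂ _+_ (countFrom-exchange P per pre 1 q x a y post)
                   (pairCount-exchange P per pre x a y post) ⟩
    countFrom P 1 q (pre ++ L′) + (pairCount P (pre ++ L′) + windowPairs P x a y)
      ≡⟨ sym (ℕₚ.+-assoc (countFrom P 1 q (pre ++ L′)) _ _) ⟩
    (countFrom P 1 q (pre ++ L′) + pairCount P (pre ++ L′)) + windowPairs P x a y ∎
    where
    L L′ : List ℤ
    L = x ∷ a ∷ y ∷ post
    L′ = y ∷ a ∷ x ∷ post

  pairCount-exchange-invariant : ∀ P → Periodic₂ P → ∀ pre x a y post →
    windowPairs P y a x ≡ windowPairs P x a y →
    pairCount P (pre ++ x ∷ a ∷ y ∷ post) ≡ pairCount P (pre ++ y ∷ a ∷ x ∷ post)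
  pairCount-exchange-invariant P per pre x a y post same =
    ℕₚ.+-cancelʳ-≡ _ _ _ (trans (pairCount-exchange P per pre x a y post)
      (cong (pairCount P (pre ++ y ∷ a ∷ x ∷ post) +_) (sym same)))

  posCount-exchange : ∀ Q → PosPeriodic₂ Q → ∀ pre i x a y post →
    posCount Q i (pre ++ x ∷ a ∷ y ∷ post) ≡ posCount Q i (pre ++ y ∷ a ∷ x ∷ post)
  posCount-exchange Q per [] i x a y post rewrite per i y | per i x =
    reorder (count (Q i x)) (count (Q (suc i) a)) (count (Q i y)) _
    where
    reorder : ∀ X A Y R → X + (A + (Y + R)) ≡ Y + (A + (X + R))
    reorder = solve-∀
  posCount-exchange Q per (q ∷ pre) i x a y post =
    cong (count (Q i q) +_) (posCount-exchange Q per pre (suc i) x a y post)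

  countFrom-const : ∀ P a (Q : ℕ → Bool) σ → All (λ v → ∀ e → P e a v ≡ Q e) σ →
    ∀ d → countFrom P d a σ ≡ countRange Q d (length σ)
  countFrom-const P a Q [] [] d = refl
  countFrom-const P a Q (v ∷ σ) (h ∷ hs) d =
    cong₂ _+_ (cong count (h d)) (countFrom-const P a Q σ hs (suc d))

  posCount-shift : ∀ Q Q′ → (∀ i v → Q (suc i) v ≡ Q′ i v) → ∀ i σ →
    posCount Q (suc i) σ ≡ posCount Q′ i σ
  posCount-shift Q Q′ h i [] = refl
  posCount-shift Q Q′ h i (v ∷ σ) = cong₂ _+_ (cong count (h i v)) (posCount-shift Q Q′ h (suc i) σ)

  lastPairs : PairPred → List ℤ → ℤ → ℕ
  lastPairs P [] a = 0
  lastPairs P (p ∷ σ) a = count (P (suc (length σ)) p a) + lastPairs P σ a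

  lastPairs-const : ∀ P a (Q : ℕ → Bool) σ → All (λ v → ∀ e → P e v a ≡ Q e) σ →
    lastPairs P σ a ≡ countRange Q 1 (length σ)
  lastPairs-const P a Q [] [] = refl
  lastPairs-const P a Q (v ∷ σ) (h ∷ hs) = begin
    count (P (suc (length σ)) v a) + lastPairs P σ a
      ≡⟨ cong₂ _+_ (cong count (h _)) (lastPairs-const P a Q σ hs) ⟩
    count (Q (suc (length σ))) + countRange Q 1 (length σ)
      ≡⟨ ℕₚ.+-comm (count (Q (suc (length σ)))) _ ⟩
    countRange Q 1 (length σ) + count (Q (suc (length σ)))
      ≡⟨ sym (countRange-snoc Q 1 (length σ)) ⟩
    countRange Q 1 (suc (length σ)) ∎

  countFrom-snoc : ∀ P d p σ a →
    countFrom P d p (σ ++ a ∷ []) ≡ countFrom P d p σ + count (P (d + length σ) p a)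
  countFrom-snoc P d p [] a rewrite ℕₚ.+-identityʳ d = ℕₚ.+-identityʳ _
  countFrom-snoc P d p (q ∷ σ) a rewrite countFrom-snoc P (suc d) p σ a | ℕₚ.+-suc d (length σ) =
    sym (ℕₚ.+-assoc (count (P d p q)) _ _)

  pairCount-snoc : ∀ P σ a → pairCount P (σ ++ a ∷ []) ≡ pairCount P σ + lastPairs P σ a
  pairCount-snoc P [] a = refl
  pairCount-snoc P (p ∷ σ) a rewrite countFrom-snoc P 1 p σ a | pairCount-snoc P σ a =
    reorder (countFrom P 1 p σ) (pairCount P σ) _ _
    where
    reorder : ∀ A B C D → (A + C) + (B + D) ≡ (A + B) + (C + D)
    reorder = solve-∀

  posCount-snoc : ∀ Q i σ a → posCount Q i (σ ++ a ∷ []) ≡ posCount Q i σ + count (Q (i + length σ) a)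
  posCount-snoc Q i [] a rewrite ℕₚ.+-identityʳ i = ℕₚ.+-identityʳ _
  posCount-snoc Q i (q ∷ σ) a rewrite posCount-snoc Q (suc i) σ a | ℕₚ.+-suc i (length σ) =
    sym (ℕₚ.+-assoc (count (Q i q)) _ _)

  Pinv Pnsp Poinv Pensp : PairPred
  Pinv = λ d a b → does (b ℤ.<? a)
  Pnsp = λ d a b → isNeg (a ℤ.+ b)
  Poinv = λ d a b → if isOdd d then does (b ℤ.<? a) else false
  Pensp = λ d a b → if isOdd d then false else isNeg (a ℤ.+ b)

  Qnneg Qoneg Qeneg : PosPred
  Qnneg = λ i a → isNeg a
  Qoneg = λ i a → if isOdd i then isNeg a else false
  Qeneg = λ i a → if isOdd i then false else isNeg a

  Poinv-periodic : Periodic₂ Poinv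
  Poinv-periodic d a b = cong (λ t → if t then does (b ℤ.<? a) else false) (isOdd-+2 d)

  Pensp-periodic : Periodic₂ Pensp
  Pensp-periodic d a b = cong (λ t → if t then false else isNeg (a ℤ.+ b)) (isOdd-+2 d)

  Qoneg-periodic : PosPeriodic₂ Qoneg
  Qoneg-periodic i v = cong (λ t → if t then isNeg v else false) (isOdd-+2 i)

  Qeneg-periodic : PosPeriodic₂ Qeneg
  Qeneg-periodic i v = cong (λ t → if t then false else isNeg v) (isOdd-+2 i)

  Qoneg-shift : ∀ i v → Qoneg (suc i) v ≡ Qeneg i v
  Qoneg-shift i v rewrite isOdd-suc i with isOdd i
  ... | true = refl
  ... | false = refl

  Qeneg-shift : ∀ i v → Qeneg (suc i) v ≡ Qoneg i v
  Qeneg-shift i v rewrite isOdd-suc i with isOdd i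
  ... | true = refl
  ... | false = refl

  count-not : ∀ s → count (not s) + count s ≡ 1
  count-not true = refl
  count-not false = refl

  statsOf-exchange : ∀ {n a s} → Dominant n a s → ∀ pre x y post →
    ∣ x ∣ ≤ n → ∣ y ∣ ≤ n → does (x ℤ.<? y) ≡ true → does (y ℤ.<? x) ≡ false →
    statsOf (pre ++ y ∷ a ∷ x ∷ post) ≡ lengthen (statsOf (pre ++ x ∷ a ∷ y ∷ post))
  statsOf-exchange {n} {a} {s} dom pre x y post bx by x<y y≮x =
    exps-≡ length-step (sym (posCount-exchange Qoneg Qoneg-periodic pre 1 x a y post))
      (sym (posCount-exchange Qeneg Qeneg-periodic pre 1 x a y post))
      (sym (pairCount-exchange-invariant Poinv Poinv-periodic pre x a y post
             (cong₂ (λ u w → count u + count w + 0)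
               (trans (above y by) (sym (above x bx))) (trans (below x bx) (sym (below y by))))))
      (sym (pairCount-exchange-invariant Pensp Pensp-periodic pre x a y post
             (cong (λ t → count (isNeg t)) (ℤₚ.+-comm y x))))
    where
    open Dominant dom
    L L′ : List ℤ
    L = pre ++ x ∷ a ∷ y ∷ post
    L′ = pre ++ y ∷ a ∷ x ∷ post

    window-inv : ∀ u w → ∣ u ∣ ≤ n → ∣ w ∣ ≤ n → windowPairs Pinv w a u ≡ suc (count (does (u ℤ.<? w)))
    window-inv u w bu bw = cong (_+ count (does (u ℤ.<? w)))
      (trans (cong₂ (λ p q → count p + count q) (above w bw) (below u bu)) (count-not s))

    inv-step : inv L′ ≡ suc (inv L)
    inv-step = ℕₚ.+-cancelʳ-≡ 1 (inv L′) (suc (inv L)) (begin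
      inv L′ + 1                               ≡⟨ cong (λ t → inv L′ + suc (count t)) (sym y≮x) ⟩
      inv L′ + suc (count (does (y ℤ.<? x)))   ≡⟨ cong (inv L′ +_) (sym (window-inv y x by bx)) ⟩
      inv L′ + windowPairs Pinv x a y          ≡⟨ sym (pairCount-exchange Pinv (λ _ _ _ → refl) pre x a y post) ⟩
      inv L + windowPairs Pinv y a x           ≡⟨ cong (inv L +_) (window-inv x y bx by) ⟩
      inv L + suc (count (does (x ℤ.<? y)))    ≡⟨ cong (λ t → inv L + suc (count t)) x<y ⟩
      inv L + 2                                ≡⟨ ℕₚ.+-suc (inv L) 1 ⟩
      suc (inv L) + 1                          ∎)

    nsp-same : nsp L′ ≡ nsp L
    nsp-same = sym (pairCount-exchange-invariant Pnsp (λ _ _ _ → refl) pre x a y post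
      (trans (cong₂ (λ u w → count u + count w + count (isNeg (y ℤ.+ x)))
                (trans (sumʳ y by) (sym (sumʳ x bx))) (trans (sumˡ x bx) (sym (sumˡ y by))))
             (cong (λ t → count (isNeg (x ℤ.+ a)) + count (isNeg (a ℤ.+ y)) + count (isNeg t)) (ℤₚ.+-comm y x))))

    length-step : ℓ L′ ≡ suc (ℓ L)
    length-step rewrite inv-step | nsp-same | posCount-exchange Qnneg (λ _ _ → refl) pre 1 x a y post = refl

  -- Exponents contributed by a dominating letter with flag s put in front of,
  -- resp. behind, a word of length n.  In front, every later position changes
  -- parity, hence the swapParity below.
  frontExps backExps : ℕ → Bool → Exps
  frontExps n s = exps (count s * n + count (not s) + count (not s) * n) (count (not s)) 0
                       (count s * ((1 + n) / 2)) (count (not s) * (n / 2))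
  backExps n s = exps (count (not s) * n + count (not s) + count (not s) * n)
                      (count (if isOdd (suc n) then not s else false))
                      (count (if isOdd (suc n) then false else not s))
                      (count (not s) * ((1 + n) / 2)) (count (not s) * (n / 2))

  module _ {n a s} (dom : Dominant n a s) (σ : List ℤ) (len : length σ ≡ n)
           (bounded : All (λ v → ∣ v ∣ ≤ n) σ) where
    open Dominant dom

    private
      leftOfAll : ∀ P Q → (∀ e v → ∣ v ∣ ≤ n → P e a v ≡ Q e) → countFrom P 1 a σ ≡ countRange Q 1 n
      leftOfAll P Q h = trans (countFrom-const P a Q σ (All.map (λ {v} hv e → h e v hv) bounded) 1)
                              (cong (countRange Q 1) len)

      rightOfAll : ∀ P Q → (∀ e v → ∣ v ∣ ≤ n → P e v a ≡ Q e) → lastPairs P σ a ≡ countRange Q 1 n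
      rightOfAll P Q h = trans (lastPairs-const P a Q σ (All.map (λ {v} hv e → h e v hv) bounded))
                               (cong (countRange Q 1) len)

      collect : ∀ A B C i p q → (A + i) + (B + p) + (C + q) ≡ (A + B + C) + (i + p + q)
      collect = solve-∀

      collect′ : ∀ A B C i p q → (i + A) + (p + B) + (q + C) ≡ (i + p + q) + (A + B + C)
      collect′ = solve-∀

    statsOf-front : statsOf (a ∷ σ) ≡ frontExps n s ⊕ swapParity (statsOf σ)
    statsOf-front = exps-≡ length-front
      (cong₂ (λ b t → count b + t) sign (posCount-shift Qoneg Qeneg Qoneg-shift 1 σ))
      (posCount-shift Qeneg Qoneg Qeneg-shift 1 σ)
      (cong (_+ oinv σ) (trans (leftOfAll Poinv _ (λ e v hv → cong (λ t → if isOdd e then t else false) (below v hv)))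
                               (countRange-odd s n)))
      (cong (_+ ensp σ) (trans (leftOfAll Pensp _ (λ e v hv → cong (λ t → if isOdd e then false else t) (sumˡ v hv)))
                               (countRange-even (not s) n)))
      where
      length-front : ℓ (a ∷ σ) ≡ (count s * n + count (not s) + count (not s) * n) + ℓ σ
      length-front = trans
        (cong₂ _+_ (cong₂ _+_
          (cong (_+ inv σ) (trans (leftOfAll Pinv (λ _ → s) (λ _ v hv → below v hv)) (countRange-const s 1 n)))
          (cong₂ (λ b t → count b + t) sign (posCount-shift Qnneg Qnneg (λ _ _ → refl) 1 σ)))
          (cong (_+ nsp σ) (trans (leftOfAll Pnsp (λ _ → not s) (λ _ v hv → sumˡ v hv)) (countRange-const (not s) 1 n))))
        (collect (count s * n) (count (not s)) (count (not s) * n) (inv σ) (nneg σ) (nsp σ))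

    statsOf-back : statsOf (σ ++ a ∷ []) ≡ statsOf σ ⊕ backExps n s
    statsOf-back = exps-≡ length-back
      (trans (posCount-snoc Qoneg 1 σ a)
             (cong₂ (λ m b → oneg σ + count (if isOdd (suc m) then b else false)) len sign))
      (trans (posCount-snoc Qeneg 1 σ a)
             (cong₂ (λ m b → eneg σ + count (if isOdd (suc m) then false else b)) len sign))
      (trans (pairCount-snoc Poinv σ a) (cong (oinv σ +_)
        (trans (rightOfAll Poinv _ (λ e v hv → cong (λ t → if isOdd e then t else false) (above v hv)))
               (countRange-odd (not s) n))))
      (trans (pairCount-snoc Pensp σ a) (cong (ensp σ +_)
        (trans (rightOfAll Pensp _ (λ e v hv → cong (λ t → if isOdd e then false else t) (sumʳ v hv)))
               (countRange-even (not s) n))))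
      where
      length-back : ℓ (σ ++ a ∷ []) ≡ ℓ σ + (count (not s) * n + count (not s) + count (not s) * n)
      length-back = trans
        (cong₂ _+_ (cong₂ _+_
          (trans (pairCount-snoc Pinv σ a) (cong (inv σ +_)
            (trans (rightOfAll Pinv (λ _ → not s) (λ _ v hv → above v hv)) (countRange-const (not s) 1 n))))
          (trans (posCount-snoc Qnneg 1 σ a) (cong (λ b → nneg σ + count b) sign)))
          (trans (pairCount-snoc Pnsp σ a) (cong (nsp σ +_)
            (trans (rightOfAll Pnsp (λ _ → not s) (λ _ v hv → sumʳ v hv)) (countRange-const (not s) 1 n)))))
        (collect′ (count (not s) * n) (count (not s)) (count (not s) * n) (inv σ) (nneg σ) (nsp σ))

-- The ring solver of Algebra.Solver.Ring, instantiated for an arbitrary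
-- commutative ring with integer coefficients, so that identities whose
-- verification needs cancellation (such as 1 - 1 = 0) can be normalised.
-- An integer is represented by a pair (a , b) standing for a - b.
module IntegerCoefficients {c l} (R : CommutativeRing c l) where

  open CommutativeRing R
  open import Algebra.Bundles using (RawRing)
  open import Algebra.Properties.Ring ring
    using (+-cancelʳ; -‿involutive; -‿+-comm; -‿distribˡ-*; -‿distribʳ-*; -0#≈0#)
  open import Algebra.Properties.Semiring.Mult semiring using (×-homo-+; ×1-homo-*) renaming (_×_ to _·_)
  open import Algebra.Properties.CommutativeSemigroup +-commutativeSemigroup using () renaming (interchange to +-interchange)
  open import Algebra.Solver.Ring.AlmostCommutativeRing
    using (fromCommutativeRing; _-Raw-AlmostCommutative⟶_)
  import Algebra.Solver.Ring as RingSolver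
  open import Data.Nat as ℕ using (ℕ; suc; _∸_)
  import Data.Nat.Properties as ℕₚ
  open import Data.Product using (_×_; _,_)
  open import Data.Maybe using (Maybe; just; nothing)
  open import Data.Sum using (_⊎_; inj₁; inj₂)
  open import Relation.Nullary using (yes; no)
  import Relation.Binary.PropositionalEquality as ≡
  open import Relation.Binary.Reasoning.Setoid setoid

  -- canon picks the representative with a zero component, so that equal
  -- integers become identical coefficients.
  canon : ℕ → ℕ → ℕ × ℕ
  canon a b = (a ∸ b , b ∸ a)

  ℤ-coefficients : RawRing _ _
  ℤ-coefficients = record
    { Carrier = ℕ × ℕ ; _≈_ = ≡._≡_
    ; _+_ = λ { (a , b) (c , d) → canon (a ℕ.+ c) (b ℕ.+ d) }
    ; _*_ = λ { (a , b) (c , d) → canon (a ℕ.* c ℕ.+ b ℕ.* d) (a ℕ.* d ℕ.+ b ℕ.* c) }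
    ; -_ = λ { (a , b) → (b , a) }
    ; 0# = (0 , 0) ; 1# = (1 , 0) }

  ⟪_⟫ : ℕ × ℕ → Carrier
  ⟪ a , b ⟫ = a · 1# - b · 1#

  diff-+ : ∀ x u v → (x - u) + (u + v) ≈ x + v
  diff-+ x u v = begin
    (x - u) + (u + v)    ≈⟨ +-assoc x (- u) (u + v) ⟩
    x + (- u + (u + v))  ≈⟨ +-congˡ (sym (+-assoc (- u) u v)) ⟩
    x + ((- u + u) + v)  ≈⟨ +-congˡ (+-congʳ (-‿inverseˡ u)) ⟩
    x + (0# + v)         ≈⟨ +-congˡ (+-identityˡ v) ⟩
    x + v                ∎

  ⟪⟫-≈ : ∀ a b c d → a ℕ.+ d ≡.≡ b ℕ.+ c → ⟪ a , b ⟫ ≈ ⟪ c , d ⟫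
  ⟪⟫-≈ a b c d eq = +-cancelʳ (b · 1# + d · 1#) ⟪ a , b ⟫ ⟪ c , d ⟫ (begin
    ⟪ a , b ⟫ + (b · 1# + d · 1#)  ≈⟨ diff-+ (a · 1#) (b · 1#) (d · 1#) ⟩
    a · 1# + d · 1#                ≈⟨ sym (×-homo-+ 1# a d) ⟩
    (a ℕ.+ d) · 1#                 ≡⟨ ≡.cong (_· 1#) eq ⟩
    (b ℕ.+ c) · 1#                 ≈⟨ ×-homo-+ 1# b c ⟩
    b · 1# + c · 1#                ≈⟨ +-comm (b · 1#) (c · 1#) ⟩
    c · 1# + b · 1#                ≈⟨ sym (diff-+ (c · 1#) (d · 1#) (b · 1#)) ⟩
    ⟪ c , d ⟫ + (d · 1# + b · 1#)  ≈⟨ +-congˡ (+-comm (d · 1#) (b · 1#)) ⟩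
    ⟪ c , d ⟫ + (b · 1# + d · 1#)  ∎)

  canon-≈ : ∀ a b → ⟪ canon a b ⟫ ≈ ⟪ a , b ⟫
  canon-≈ a b = ⟪⟫-≈ (a ∸ b) (b ∸ a) a b (balance (ℕₚ.≤-total a b))
    where
    balance : a ℕ.≤ b ⊎ b ℕ.≤ a → (a ∸ b) ℕ.+ b ≡.≡ (b ∸ a) ℕ.+ a
    balance (inj₁ a≤b) = ≡.trans (≡.cong (ℕ._+ b) (ℕₚ.m≤n⇒m∸n≡0 a≤b)) (≡.sym (ℕₚ.m∸n+n≡m a≤b))
    balance (inj₂ b≤a) = ≡.trans (ℕₚ.m∸n+n≡m b≤a) (≡.cong (ℕ._+ a) (≡.sym (ℕₚ.m≤n⇒m∸n≡0 b≤a)))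

  neg-+ : ∀ x y → - (x + y) ≈ - x + - y
  neg-+ x y = sym (-‿+-comm x y)

  ⟪⟫-+ : ∀ p q → ⟪ RawRing._+_ ℤ-coefficients p q ⟫ ≈ ⟪ p ⟫ + ⟪ q ⟫
  ⟪⟫-+ (a , b) (c , d) = begin
    ⟪ canon (a ℕ.+ c) (b ℕ.+ d) ⟫            ≈⟨ canon-≈ (a ℕ.+ c) (b ℕ.+ d) ⟩
    (a ℕ.+ c) · 1# - (b ℕ.+ d) · 1#        ≈⟨ +-cong (×-homo-+ 1# a c) (-‿cong (×-homo-+ 1# b d)) ⟩
    (a · 1# + c · 1#) - (b · 1# + d · 1#)  ≈⟨ +-congˡ (neg-+ (b · 1#) (d · 1#)) ⟩
    (a · 1# + c · 1#) + (- (b · 1#) + - (d · 1#)) ≈⟨ +-interchange _ _ _ _ ⟩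
    ⟪ a , b ⟫ + ⟪ c , d ⟫                  ∎

  ⟪⟫-* : ∀ p q → ⟪ RawRing._*_ ℤ-coefficients p q ⟫ ≈ ⟪ p ⟫ * ⟪ q ⟫
  ⟪⟫-* (a , b) (c , d) = begin
    ⟪ canon (a ℕ.* c ℕ.+ b ℕ.* d) (a ℕ.* d ℕ.+ b ℕ.* c) ⟫
      ≈⟨ canon-≈ (a ℕ.* c ℕ.+ b ℕ.* d) (a ℕ.* d ℕ.+ b ℕ.* c) ⟩
    (a ℕ.* c ℕ.+ b ℕ.* d) · 1# - (a ℕ.* d ℕ.+ b ℕ.* c) · 1#
      ≈⟨ +-cong (trans (×-homo-+ 1# (a ℕ.* c) (b ℕ.* d)) (+-cong (×1-homo-* a c) (×1-homo-* b d)))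
                (-‿cong (trans (×-homo-+ 1# (a ℕ.* d) (b ℕ.* c)) (+-cong (×1-homo-* a d) (×1-homo-* b c)))) ⟩
    (A * C + B′ * D) - (A * D + B′ * C)
      ≈⟨ +-congˡ (neg-+ (A * D) (B′ * C)) ⟩
    (A * C + B′ * D) + (- (A * D) + - (B′ * C))
      ≈⟨ +-cong (+-congˡ (sym negated-product)) (+-cong (-‿distribʳ-* A D) (-‿distribˡ-* B′ C)) ⟩
    (A * C + - B′ * - D) + (A * - D + - B′ * C)
      ≈⟨ +-interchange _ _ _ _ ⟩
    (A * C + A * - D) + (- B′ * - D + - B′ * C)
      ≈⟨ +-cong (sym (distribˡ A C (- D))) (trans (+-comm _ _) (sym (distribˡ (- B′) C (- D)))) ⟩
    A * (C - D) + - B′ * (C - D)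
      ≈⟨ sym (distribʳ (C - D) A (- B′)) ⟩
    (A - B′) * (C - D) ∎
    where
    A B′ C D : Carrier
    A = a · 1#; B′ = b · 1#; C = c · 1#; D = d · 1#
    negated-product : - B′ * - D ≈ B′ * D
    negated-product = begin
      - B′ * - D      ≈⟨ sym (-‿distribˡ-* B′ (- D)) ⟩
      - (B′ * - D)    ≈⟨ -‿cong (sym (-‿distribʳ-* B′ D)) ⟩
      - - (B′ * D)    ≈⟨ -‿involutive (B′ * D) ⟩
      B′ * D          ∎

  ⟪⟫-neg : ∀ p → ⟪ RawRing.-_ ℤ-coefficients p ⟫ ≈ - ⟪ p ⟫
  ⟪⟫-neg (a , b) = begin
    b · 1# - a · 1#          ≈⟨ +-comm _ _ ⟩
    - (a · 1#) + b · 1#      ≈⟨ +-congˡ (sym (-‿involutive _)) ⟩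
    - (a · 1#) + - - (b · 1#) ≈⟨ sym (neg-+ _ _) ⟩
    - ⟪ a , b ⟫              ∎

  -- The interpretation used by the solver; the constant one is sent to 1#
  -- itself so that solver expressions can mention 1# literally.
  ⟦_⟧ℤ : ℕ × ℕ → Carrier
  ⟦ 1 , 0 ⟧ℤ = 1#
  ⟦ p ⟧ℤ = ⟪ p ⟫

  ⟦⟧ℤ-≈ : ∀ p → ⟦ p ⟧ℤ ≈ ⟪ p ⟫
  ⟦⟧ℤ-≈ (1 , 0) = sym (begin
    (1# + 0#) + - 0#  ≈⟨ +-congˡ -0#≈0# ⟩
    (1# + 0#) + 0#    ≈⟨ +-identityʳ _ ⟩
    1# + 0#           ≈⟨ +-identityʳ 1# ⟩
    1#                ∎)
  ⟦⟧ℤ-≈ (0 , _) = refl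
  ⟦⟧ℤ-≈ (1 , suc b) = refl
  ⟦⟧ℤ-≈ (suc (suc a) , b) = refl

  homomorphism : ℤ-coefficients -Raw-AlmostCommutative⟶ fromCommutativeRing R
  homomorphism = record
    { ⟦_⟧ = ⟦_⟧ℤ
    ; +-homo = λ p q → trans (⟦⟧ℤ-≈ (RawRing._+_ ℤ-coefficients p q)) (trans (⟪⟫-+ p q) (sym (+-cong (⟦⟧ℤ-≈ p) (⟦⟧ℤ-≈ q))))
    ; *-homo = λ p q → trans (⟦⟧ℤ-≈ (RawRing._*_ ℤ-coefficients p q)) (trans (⟪⟫-* p q) (sym (*-cong (⟦⟧ℤ-≈ p) (⟦⟧ℤ-≈ q))))
    ; -‿homo = λ p → trans (⟦⟧ℤ-≈ (RawRing.-_ ℤ-coefficients p)) (trans (⟪⟫-neg p) (sym (-‿cong (⟦⟧ℤ-≈ p))))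
    ; 0-homo = -‿inverseʳ 0#
    ; 1-homo = refl }

  decide : ∀ p q → Maybe (⟦ p ⟧ℤ ≈ ⟦ q ⟧ℤ)
  decide (a , b) (c , d) with a ℕ.+ d ℕ.≟ b ℕ.+ c
  ... | yes eq = just (trans (⟦⟧ℤ-≈ (a , b)) (trans (⟪⟫-≈ a b c d eq) (sym (⟦⟧ℤ-≈ (c , d)))))
  ... | no _ = nothing

  open RingSolver ℤ-coefficients (fromCommutativeRing R) homomorphism decide public

  one : ℕ × ℕ
  one = (1 , 0)

module Sums {c l} (R : CommutativeRing c l) where

  open CommutativeRing R
  open import Algebra.Properties.CommutativeSemigroup +-commutativeSemigroup
    using (x∙yz≈y∙xz) renaming (interchange to +-interchange)
  open Lists
  open SignedPermutations
  open import Data.Nat as ℕ using (ℕ; zero; suc; _≤_; _<_; s≤s; z≤n) renaming (_+_ to _+ℕ_)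
  import Data.Nat.Properties as ℕₚ
  open import Data.Integer as ℤ using (ℤ; +_; -[1+_])
  open import Data.List using (List; []; _∷_; _++_; length; map; concatMap)
  open import Data.List.Relation.Unary.All using (All; []; _∷_)
  open import Data.Product using (_,_)
  open import Relation.Nullary using (Dec; yes; no)
  import Relation.Binary.PropositionalEquality as ≡
  open import Relation.Binary.Reasoning.Setoid setoid

  ΣL : {X : Set} → (X → Carrier) → List X → Carrier
  ΣL f xs = sumL R (map f xs)

  Σ< : ℕ → (ℕ → Carrier) → Carrier
  Σ< zero f = 0#
  Σ< (suc N) f = f 0 + Σ< N (λ k → f (suc k))

  Σ<-cong : ∀ N {f g : ℕ → Carrier} → (∀ k → k < N → f k ≈ g k) → Σ< N f ≈ Σ< N g
  Σ<-cong zero h = refl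
  Σ<-cong (suc N) h = +-cong (h 0 (s≤s z≤n)) (Σ<-cong N (λ k k<N → h (suc k) (s≤s k<N)))

  Σ<-split : ∀ a b f → Σ< (a +ℕ b) f ≈ Σ< a f + Σ< b (λ k → f (a +ℕ k))
  Σ<-split zero b f = sym (+-identityˡ _)
  Σ<-split (suc a) b f = trans (+-congˡ (Σ<-split a b (λ k → f (suc k)))) (sym (+-assoc _ _ _))

  Σ<-snoc : ∀ N f → Σ< (suc N) f ≈ Σ< N f + f N
  Σ<-snoc zero f = trans (+-identityʳ _) (sym (+-identityˡ _))
  Σ<-snoc (suc N) f = trans (+-congˡ (Σ<-snoc N (λ k → f (suc k)))) (sym (+-assoc _ _ _))

  Σ<-0 : ∀ N → Σ< N (λ _ → 0#) ≈ 0#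
  Σ<-0 zero = refl
  Σ<-0 (suc N) = trans (+-identityˡ _) (Σ<-0 N)

  Σ<-+ : ∀ N f g → Σ< N (λ k → f k + g k) ≈ Σ< N f + Σ< N g
  Σ<-+ zero f g = sym (+-identityʳ 0#)
  Σ<-+ (suc N) f g = trans (+-congˡ (Σ<-+ N (λ k → f (suc k)) (λ k → g (suc k)))) (+-interchange _ _ _ _)

  ΣL-cong : {X : Set} {f g : X → Carrier} (xs : List X) → (∀ x → f x ≈ g x) → ΣL f xs ≈ ΣL g xs
  ΣL-cong [] h = refl
  ΣL-cong (x ∷ xs) h = +-cong (h x) (ΣL-cong xs h)

  ΣL-congAll : {X : Set} {P : X → Set} {f g : X → Carrier} {xs : List X} → All P xs →
    (∀ {x} → P x → f x ≈ g x) → ΣL f xs ≈ ΣL g xs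
  ΣL-congAll [] h = refl
  ΣL-congAll (p ∷ ps) h = +-cong (h p) (ΣL-congAll ps h)

  ΣL-++ : {X : Set} (f : X → Carrier) → ∀ xs ys → ΣL f (xs ++ ys) ≈ ΣL f xs + ΣL f ys
  ΣL-++ f [] ys = sym (+-identityˡ _)
  ΣL-++ f (x ∷ xs) ys = trans (+-congˡ (ΣL-++ f xs ys)) (sym (+-assoc _ _ _))

  ΣL-concatMap : {X Y : Set} (f : Y → Carrier) (g : X → List Y) → ∀ xs →
    ΣL f (concatMap g xs) ≈ ΣL (λ x → ΣL f (g x)) xs
  ΣL-concatMap f g [] = refl
  ΣL-concatMap f g (x ∷ xs) = trans (ΣL-++ f (g x) (concatMap g xs)) (+-congˡ (ΣL-concatMap f g xs))

  ΣL-map : {X Y : Set} (f : Y → Carrier) (g : X → Y) → ∀ xs → ΣL f (map g xs) ≈ ΣL (λ x → f (g x)) xs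
  ΣL-map f g [] = refl
  ΣL-map f g (x ∷ xs) = +-congˡ (ΣL-map f g xs)

  ΣL-+ : {X : Set} (f g : X → Carrier) → ∀ xs → ΣL (λ x → f x + g x) xs ≈ ΣL f xs + ΣL g xs
  ΣL-+ f g [] = sym (+-identityʳ 0#)
  ΣL-+ f g (x ∷ xs) = trans (+-congˡ (ΣL-+ f g xs)) (+-interchange _ _ _ _)

  ΣL-* : {X : Set} (a : Carrier) (f : X → Carrier) → ∀ xs → ΣL (λ x → a * f x) xs ≈ a * ΣL f xs
  ΣL-* a f [] = sym (zeroʳ a)
  ΣL-* a f (x ∷ xs) = trans (+-congˡ (ΣL-* a f xs)) (sym (distribˡ a _ _))

  ΣL-0 : {X : Set} (xs : List X) → ΣL (λ _ → 0#) xs ≈ 0#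
  ΣL-0 [] = refl
  ΣL-0 (x ∷ xs) = trans (+-identityˡ _) (ΣL-0 xs)

  ΣL-Σ< : {X : Set} → ∀ N (h : X → ℕ → Carrier) xs →
    ΣL (λ x → Σ< N (h x)) xs ≈ Σ< N (λ k → ΣL (λ x → h x k) xs)
  ΣL-Σ< N h [] = sym (Σ<-0 N)
  ΣL-Σ< N h (x ∷ xs) = trans (+-congˡ (ΣL-Σ< N h xs)) (sym (Σ<-+ N (h x) (λ k → ΣL (λ x → h x k) xs)))

  ΣL-insertAll : {X : Set} (F : List X → Carrier) → ∀ a p →
    ΣL F (insertAll a p) ≈ Σ< (suc (length p)) (λ k → F (insertAt k a p))
  ΣL-insertAll F a [] = refl
  ΣL-insertAll F a (y ∷ ys) =
    +-congˡ (trans (ΣL-map F (y ∷_) (insertAll a ys)) (ΣL-insertAll (λ q → F (y ∷ q)) a ys))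

  ΣL-signings-∷ : ∀ (m : ℕ) p (F : List ℤ → Carrier) →
    ΣL F (signings (m ∷ p)) ≈ ΣL (λ s → F (+ m ∷ s) + F (ℤ.- (+ m) ∷ s)) (signings p)
  ΣL-signings-∷ m p F = trans (ΣL-concatMap F _ (signings p))
                                (ΣL-cong (signings p) (λ s → +-congˡ (+-identityʳ _)))

  ΣL-signings-insertAt : ∀ (m : ℕ) k p (F : List ℤ → Carrier) →
    ΣL F (signings (insertAt k m p)) ≈ ΣL (λ s → F (insertAt k (+ m) s) + F (insertAt k (ℤ.- (+ m)) s)) (signings p)
  ΣL-signings-insertAt m zero p F = ΣL-signings-∷ m p F
  ΣL-signings-insertAt m (suc k) [] F = ΣL-signings-∷ m [] F
  ΣL-signings-insertAt m (suc k) (a ∷ p) F = begin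
      ΣL F (signings (a ∷ insertAt k m p))
        ≈⟨ ΣL-signings-∷ a (insertAt k m p) F ⟩
      ΣL G (signings (insertAt k m p))
        ≈⟨ ΣL-signings-insertAt m k p G ⟩
      ΣL (λ s → G (insertAt k (+ m) s) + G (insertAt k (ℤ.- (+ m)) s)) (signings p)
        ≈⟨ ΣL-cong (signings p) (λ s → +-interchange _ _ _ _) ⟩
      ΣL (λ s → H (+ a ∷ s) + H (ℤ.- (+ a) ∷ s)) (signings p)
        ≈⟨ sym (ΣL-signings-∷ a p H) ⟩
      ΣL H (signings (a ∷ p)) ∎
    where
    G H : List ℤ → Carrier
    G s = F (+ a ∷ s) + F (ℤ.- (+ a) ∷ s)
    H s = F (insertAt (suc k) (+ m) s) + F (insertAt (suc k) (ℤ.- (+ m)) s)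

  bothSigns : ℕ → (List ℤ → Carrier) → ℕ → List ℤ → Carrier
  bothSigns n F k σ = F (insertAt k (+ suc n) σ) + F (insertAt k -[1+ n ] σ)

  ΣL-B-suc : ∀ n (F : List ℤ → Carrier) →
    ΣL F (B (suc n)) ≈ ΣL (λ σ → Σ< (suc n) (λ k → bothSigns n F k σ)) (B n)
  ΣL-B-suc n F = begin
      ΣL F (concatMap signings (concatMap (insertAll (suc n)) (perms n)))
        ≈⟨ ΣL-concatMap F signings (concatMap (insertAll (suc n)) (perms n)) ⟩
      ΣL (λ q → ΣL F (signings q)) (concatMap (insertAll (suc n)) (perms n))
        ≈⟨ ΣL-concatMap _ (insertAll (suc n)) (perms n) ⟩
      ΣL (λ p → ΣL (λ q → ΣL F (signings q)) (insertAll (suc n) p)) (perms n)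
        ≈⟨ ΣL-congAll (perms-perm n) (λ {p} (len , _) → per-permutation p len) ⟩
      ΣL (λ p → ΣL (λ σ → Σ< (suc n) (λ k → bothSigns n F k σ)) (signings p)) (perms n)
        ≈⟨ sym (ΣL-concatMap _ signings (perms n)) ⟩
      ΣL (λ σ → Σ< (suc n) (λ k → bothSigns n F k σ)) (B n) ∎
    where
    per-permutation : ∀ p → length p ≡.≡ n →
      ΣL (λ q → ΣL F (signings q)) (insertAll (suc n) p)
      ≈ ΣL (λ σ → Σ< (suc n) (λ k → bothSigns n F k σ)) (signings p)
    per-permutation p len = begin
      ΣL (λ q → ΣL F (signings q)) (insertAll (suc n) p)
        ≈⟨ ΣL-insertAll (λ q → ΣL F (signings q)) (suc n) p ⟩
      Σ< (suc (length p)) (λ k → ΣL F (signings (insertAt k (suc n) p)))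
        ≡⟨ ≡.cong (λ m → Σ< (suc m) (λ k → ΣL F (signings (insertAt k (suc n) p)))) len ⟩
      Σ< (suc n) (λ k → ΣL F (signings (insertAt k (suc n) p)))
        ≈⟨ Σ<-cong (suc n) (λ k _ → ΣL-signings-insertAt (suc n) k p F) ⟩
      Σ< (suc n) (λ k → ΣL (bothSigns n F k) (signings p))
        ≈⟨ sym (ΣL-Σ< (suc n) (λ σ k → bothSigns n F k σ) (signings p)) ⟩
      ΣL (λ σ → Σ< (suc n) (λ k → bothSigns n F k σ)) (signings p) ∎

  bothSigns-swapAt : ∀ n (F : List ℤ → Carrier) j k k′ σ τ →
    (∀ a → swapAt j (insertAt k a σ) ≡.≡ insertAt k′ a τ) →
    bothSigns n (λ ρ → F (swapAt j ρ)) k σ ≈ bothSigns n F k′ τ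
  bothSigns-swapAt n F j k k′ σ τ h =
    +-cong (reflexive (≡.cong F (h (+ suc n)))) (reflexive (≡.cong F (h -[1+ n ])))

  insertionsBefore : ℕ → (List ℤ → Carrier) → ℕ → List ℤ → Carrier
  insertionsBefore n F j τ = Σ< j (λ k → bothSigns n F k τ)

  insertionsAfter : ℕ → (List ℤ → Carrier) → ℕ → ℕ → List ℤ → Carrier
  insertionsAfter n F j r τ = Σ< r (λ t → bothSigns n F (j +ℕ suc (suc t)) τ)

  insertions-around : ∀ F j r σ → let n = suc j +ℕ r in
    Σ< (suc n) (λ k → bothSigns n F k σ)
    ≈ insertionsBefore n F j σ + (bothSigns n F j σ + (bothSigns n F (suc j) σ + insertionsAfter n F j r σ))
  insertions-around F j r σ = begin
      Σ< (suc (suc j +ℕ r)) g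
        ≡⟨ ≡.cong (λ N → Σ< N g) (≡.trans (≡.cong suc (≡.sym (ℕₚ.+-suc j r))) (≡.sym (ℕₚ.+-suc j (suc r)))) ⟩
      Σ< (j +ℕ suc (suc r)) g
        ≈⟨ Σ<-split j (suc (suc r)) g ⟩
      Σ< j g + (g (j +ℕ 0) + (g (j +ℕ 1) + Σ< r (λ t → g (j +ℕ suc (suc t)))))
        ≡⟨ ≡.cong₂ (λ u v → Σ< j g + (g u + (g v + Σ< r (λ t → g (j +ℕ suc (suc t))))))
                   (ℕₚ.+-identityʳ j) (ℕₚ.+-comm j 1) ⟩
      Σ< j g + (g j + (g (suc j) + Σ< r (λ t → g (j +ℕ suc (suc t))))) ∎
    where
    g : ℕ → Carrier
    g k = bothSigns (suc j +ℕ r) F k σ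

  insertionsBefore-swapAt : ∀ n F j σ →
    insertionsBefore n (λ ρ → F (swapAt j ρ)) j σ ≈ insertionsBefore n F j (swapAt (ℕ.pred j) σ)
  insertionsBefore-swapAt n F zero σ = refl
  insertionsBefore-swapAt n F (suc j) σ = Σ<-cong (suc j) (λ { k (s≤s k≤j) →
    bothSigns-swapAt n F (suc j) k k σ (swapAt j σ) (λ a → swapAt-insertAt-before j k a σ k≤j) })

  insertions-swapAt : ∀ F j r σ → let n = suc j +ℕ r in length σ ≡.≡ n →
    Σ< (suc n) (λ k → bothSigns n (λ ρ → F (swapAt j ρ)) k σ)
    ≈ insertionsBefore n F j (swapAt (ℕ.pred j) σ)
      + (bothSigns n F (suc j) σ + (bothSigns n F j σ + insertionsAfter n F j r (swapAt j σ)))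
  insertions-swapAt F j r σ len = trans (insertions-around F′ j r σ)
    (+-cong (insertionsBefore-swapAt n F j σ)
      (+-cong (bothSigns-swapAt n F j j (suc j) σ σ (λ a → swapAt-insertAt-at j a σ j<σ))
        (+-cong (bothSigns-swapAt n F j (suc j) j σ σ (λ a → swapAt-insertAt-next j a σ j<σ))
          (Σ<-cong r (λ t t<r → bothSigns-swapAt n F j _ _ σ (swapAt j σ)
            (λ a → swapAt-insertAt-after j t a σ (in-range t t<r)))))))
    where
    n = suc j +ℕ r
    F′ : List ℤ → Carrier
    F′ ρ = F (swapAt j ρ)
    j<σ : suc j ≤ length σ
    j<σ = ≡.subst (suc j ≤_) (≡.sym len) (s≤s (ℕₚ.m≤m+n j r))
    in-range : ∀ t → t < r → j +ℕ suc (suc t) ≤ length σ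
    in-range t t<r rewrite len | ℕₚ.+-suc j (suc t) = s≤s (ℕₚ.+-monoʳ-≤ j t<r)

  ΣL-+₄ : {X : Set} (f g h k : X → Carrier) → ∀ xs →
    ΣL (λ x → f x + (g x + (h x + k x))) xs ≈ ΣL f xs + (ΣL g xs + (ΣL h xs + ΣL k xs))
  ΣL-+₄ f g h k xs = trans (ΣL-+ f _ xs) (+-congˡ (trans (ΣL-+ g _ xs) (+-congˡ (ΣL-+ h k xs))))

  -- By induction on n, sorting the words of B n by the position
  -- of ±n: the swap either misses the inserted letter (and is a swap in the
  -- shorter word) or moves it by one place.
  ΣL-swapAt : ∀ n j (F : List ℤ → Carrier) → ΣL (λ σ → F (swapAt j σ)) (B n) ≈ ΣL F (B n)
  ΣL-swapAt zero j F = +-congʳ (reflexive (≡.cong F (swapAt-[] j)))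
  ΣL-swapAt (suc n) j F = begin
      ΣL F′ (B (suc n))                                       ≈⟨ ΣL-B-suc n F′ ⟩
      ΣL (λ σ → Σ< (suc n) (λ k → bothSigns n F′ k σ)) (B n)  ≈⟨ by-position (j ℕ.<? n) ⟩
      ΣL (λ σ → Σ< (suc n) (λ k → bothSigns n F k σ)) (B n)   ≈⟨ sym (ΣL-B-suc n F) ⟩
      ΣL F (B (suc n))                                        ∎
    where
    F′ : List ℤ → Carrier
    F′ σ = F (swapAt j σ)

    by-position : Dec (j < n) →
      ΣL (λ σ → Σ< (suc n) (λ k → bothSigns n F′ k σ)) (B n) ≈ ΣL (λ σ → Σ< (suc n) (λ k → bothSigns n F k σ)) (B n)
    by-position (no j≮n) = ΣL-congAll (B-signedPerm n) λ { {σ} (len , _) →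
      Σ<-cong (suc n) (λ k _ → bothSigns-swapAt n F j k k σ σ (λ a →
        swapAt-short j (insertAt k a σ)
          (≡.subst (_≤ suc j) (≡.sym (≡.trans (length-insertAt k a σ) (≡.cong suc len)))
                   (s≤s (ℕₚ.≮⇒≥ j≮n))))) }
    by-position (yes j<n) with ℕₚ.m≤n⇒∃[o]m+o≡n j<n
    ... | r , ≡.refl = begin
        ΣL (λ σ → Σ< (suc n) (λ k → bothSigns n F′ k σ)) (B n)
          ≈⟨ ΣL-congAll (B-signedPerm n) (λ {σ} (len , _) → insertions-swapAt F j r σ len) ⟩
        ΣL (λ σ → before (swapAt (ℕ.pred j) σ) + (at (suc j) σ + (at j σ + after (swapAt j σ)))) (B n)
          ≈⟨ ΣL-+₄ _ _ _ _ (B n) ⟩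
        ΣL (λ σ → before (swapAt (ℕ.pred j) σ)) (B n)
          + (ΣL (at (suc j)) (B n) + (ΣL (at j) (B n) + ΣL (λ σ → after (swapAt j σ)) (B n)))
          ≈⟨ +-cong (ΣL-swapAt n (ℕ.pred j) before) (+-congˡ (+-congˡ (ΣL-swapAt n j after))) ⟩
        ΣL before (B n) + (ΣL (at (suc j)) (B n) + (ΣL (at j) (B n) + ΣL after (B n)))
          ≈⟨ +-congˡ (x∙yz≈y∙xz _ _ _) ⟩
        ΣL before (B n) + (ΣL (at j) (B n) + (ΣL (at (suc j)) (B n) + ΣL after (B n)))
          ≈⟨ sym (ΣL-+₄ _ _ _ _ (B n)) ⟩
        ΣL (λ σ → before σ + (at j σ + (at (suc j) σ + after σ))) (B n)
          ≈⟨ sym (ΣL-cong (B n) (insertions-around F j r)) ⟩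
        ΣL (λ σ → Σ< (suc n) (λ k → bothSigns n F k σ)) (B n) ∎
      where
      at : ℕ → List ℤ → Carrier
      at = bothSigns n F
      before after : List ℤ → Carrier
      before = insertionsBefore n F j
      after = insertionsAfter n F j r

module Recurrence {c l} (R : CommutativeRing c l) where

  open CommutativeRing R
  open IntegerCoefficients R using (solve; _:=_; con; _:*_; :-_; one)
  open Sums R
  open Parity
  open Lists
  open SignedPermutations
  open Statistics
  open import Data.Nat using (ℕ; zero; suc; _≤_; s≤s; _/_) renaming (_+_ to _+ℕ_)
  import Data.Nat.Properties as ℕₚ
  open import Data.Nat.Tactic.RingSolver using (solve-∀)
  open import Data.Integer as ℤ using (ℤ; +_; -[1+_]; ∣_∣)
  open import Data.Bool using (true; false; not; if_then_else_)
  open import Data.List using (List; []; _∷_; _++_; length)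
  open import Data.List.Relation.Unary.All using (All)
  open import Data.Product using (_,_; proj₁; proj₂)
  open import Relation.Nullary using (does)
  import Relation.Binary.PropositionalEquality as ≡
  open ≡ using (_≢_)
  open import Relation.Binary.Reasoning.Setoid setoid

  pow-+ : ∀ x a b → pow R x (a +ℕ b) ≈ pow R x a * pow R x b
  pow-+ x zero b = sym (*-identityˡ _)
  pow-+ x (suc a) b = trans (*-congˡ (pow-+ x a b)) (sym (*-assoc _ _ _))

  sgn-odd : ∀ n → sgn R (suc (n +ℕ n)) ≈ - 1#
  sgn-odd zero = *-identityʳ (- 1#)
  sgn-odd (suc n) = begin
    - 1# * (- 1# * sgn R (n +ℕ suc n))        ≡⟨ ≡.cong (λ m → - 1# * (- 1# * sgn R m)) (ℕₚ.+-suc n n) ⟩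
    - 1# * (- 1# * sgn R (suc (n +ℕ n)))      ≈⟨ *-congˡ (*-congˡ (sgn-odd n)) ⟩
    - 1# * (- 1# * - 1#)                      ≈⟨ solve 0 (:- con one :* (:- con one :* :- con one) := :- con one) refl ⟩
    - 1#                                      ∎

  -- The letter whose exponent counts negative entries at position n+1.
  letterAt : Carrier → Carrier → ℕ → Carrier
  letterAt x₁ x₂ n = if isOdd (suc n) then x₁ else x₂

  module _ (y z : Carrier) where

    mono : Carrier → Carrier → Exps → Carrier
    mono x₁ x₂ (exps a b c d e) = sgn R a * pow R x₁ b * pow R x₂ c * pow R y d * pow R z e

    weight : Carrier → Carrier → List ℤ → Carrier
    weight x₁ x₂ σ = mono x₁ x₂ (statsOf σ)

    mono-⊕ : ∀ x₁ x₂ e f → mono x₁ x₂ (e ⊕ f) ≈ mono x₁ x₂ e * mono x₁ x₂ f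
    mono-⊕ x₁ x₂ (exps a b c d e) (exps a′ b′ c′ d′ e′) = begin
      sgn R (a +ℕ a′) * pow R x₁ (b +ℕ b′) * pow R x₂ (c +ℕ c′) * pow R y (d +ℕ d′) * pow R z (e +ℕ e′)
        ≈⟨ *-cong (*-cong (*-cong (*-cong (pow-+ (- 1#) a a′) (pow-+ x₁ b b′)) (pow-+ x₂ c c′))
                                  (pow-+ y d d′)) (pow-+ z e e′) ⟩
      (S * S′) * (X₁ * X₁′) * (X₂ * X₂′) * (Y * Y′) * (Z * Z′)
        ≈⟨ solve 10 (λ S S′ X₁ X₁′ X₂ X₂′ Y Y′ Z Z′ →
                (S :* S′) :* (X₁ :* X₁′) :* (X₂ :* X₂′) :* (Y :* Y′) :* (Z :* Z′)
                := (S :* X₁ :* X₂ :* Y :* Z) :* (S′ :* X₁′ :* X₂′ :* Y′ :* Z′))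
              refl S S′ X₁ X₁′ X₂ X₂′ Y Y′ Z Z′ ⟩
      (S * X₁ * X₂ * Y * Z) * (S′ * X₁′ * X₂′ * Y′ * Z′) ∎
      where
      S S′ X₁ X₁′ X₂ X₂′ Y Y′ Z Z′ : Carrier
      S = sgn R a; S′ = sgn R a′; X₁ = pow R x₁ b; X₁′ = pow R x₁ b′; X₂ = pow R x₂ c; X₂′ = pow R x₂ c′
      Y = pow R y d; Y′ = pow R y d′; Z = pow R z e; Z′ = pow R z e′

    mono-swapParity : ∀ x₁ x₂ e → mono x₁ x₂ (swapParity e) ≈ mono x₂ x₁ e
    mono-swapParity x₁ x₂ (exps a b c d e) =
      solve 5 (λ S P Q U V → S :* P :* Q :* U :* V := S :* Q :* P :* U :* V) refl
        (sgn R a) (pow R x₁ c) (pow R x₂ b) (pow R y d) (pow R z e)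

    mono-lengthen : ∀ x₁ x₂ e → mono x₁ x₂ (lengthen e) ≈ - mono x₁ x₂ e
    mono-lengthen x₁ x₂ (exps a b c d e) =
      solve 5 (λ S P Q U V → :- con one :* S :* P :* Q :* U :* V := :- (S :* P :* Q :* U :* V)) refl
        (sgn R a) (pow R x₁ b) (pow R x₂ c) (pow R y d) (pow R z e)

    weight-front : ∀ {n a s} → Dominant n a s → ∀ x₁ x₂ σ → length σ ≡.≡ n → All (λ v → ∣ v ∣ ≤ n) σ →
      weight x₁ x₂ (a ∷ σ) ≈ mono x₁ x₂ (frontExps n s) * weight x₂ x₁ σ
    weight-front {n} {a} {s} dom x₁ x₂ σ len bounded = begin
      mono x₁ x₂ (statsOf (a ∷ σ))
        ≡⟨ ≡.cong (mono x₁ x₂) (statsOf-front dom σ len bounded) ⟩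
      mono x₁ x₂ (frontExps n s ⊕ swapParity (statsOf σ))
        ≈⟨ mono-⊕ x₁ x₂ (frontExps n s) (swapParity (statsOf σ)) ⟩
      mono x₁ x₂ (frontExps n s) * mono x₁ x₂ (swapParity (statsOf σ))
        ≈⟨ *-congˡ (mono-swapParity x₁ x₂ (statsOf σ)) ⟩
      mono x₁ x₂ (frontExps n s) * weight x₂ x₁ σ ∎

    weight-back : ∀ {n a s} → Dominant n a s → ∀ x₁ x₂ σ → length σ ≡.≡ n → All (λ v → ∣ v ∣ ≤ n) σ →
      weight x₁ x₂ (σ ++ a ∷ []) ≈ mono x₁ x₂ (backExps n s) * weight x₁ x₂ σ
    weight-back {n} {a} {s} dom x₁ x₂ σ len bounded = begin
      mono x₁ x₂ (statsOf (σ ++ a ∷ []))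
        ≡⟨ ≡.cong (mono x₁ x₂) (statsOf-back dom σ len bounded) ⟩
      mono x₁ x₂ (statsOf σ ⊕ backExps n s)
        ≈⟨ mono-⊕ x₁ x₂ (statsOf σ) (backExps n s) ⟩
      weight x₁ x₂ σ * mono x₁ x₂ (backExps n s)
        ≈⟨ *-comm _ _ ⟩
      mono x₁ x₂ (backExps n s) * weight x₁ x₂ σ ∎

    front-pos : ∀ x₁ x₂ n → mono x₁ x₂ (frontExps n true) ≈ sgn R n * pow R y ((1 +ℕ n) / 2)
    front-pos x₁ x₂ n = begin
      sgn R (n +ℕ 0 +ℕ 0 +ℕ 0) * 1# * 1# * pow R y ((1 +ℕ n) / 2 +ℕ 0) * 1#
        ≡⟨ ≡.cong₂ (λ a d → sgn R a * 1# * 1# * pow R y d * 1#) (length≡ n) (ℕₚ.+-identityʳ ((1 +ℕ n) / 2)) ⟩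
      sgn R n * 1# * 1# * pow R y ((1 +ℕ n) / 2) * 1#
        ≈⟨ solve 2 (λ S Y → S :* con one :* con one :* Y :* con one := S :* Y) refl _ _ ⟩
      sgn R n * pow R y ((1 +ℕ n) / 2) ∎
      where
      length≡ : ∀ n → n +ℕ 0 +ℕ 0 +ℕ 0 ≡.≡ n
      length≡ = solve-∀

    front-neg : ∀ x₁ x₂ n → mono x₁ x₂ (frontExps n false) ≈ sgn R (suc n) * x₁ * pow R z (n / 2)
    front-neg x₁ x₂ n = begin
      sgn R (suc (n +ℕ 0)) * (x₁ * 1#) * 1# * 1# * pow R z (n / 2 +ℕ 0)
        ≡⟨ ≡.cong₂ (λ a e → sgn R (suc a) * (x₁ * 1#) * 1# * 1# * pow R z e) (ℕₚ.+-identityʳ n) (ℕₚ.+-identityʳ (n / 2)) ⟩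
      sgn R (suc n) * (x₁ * 1#) * 1# * 1# * pow R z (n / 2)
        ≈⟨ solve 3 (λ S X Z → S :* (X :* con one) :* con one :* con one :* Z := S :* X :* Z) refl _ _ _ ⟩
      sgn R (suc n) * x₁ * pow R z (n / 2) ∎

    back-pos : ∀ x₁ x₂ n → mono x₁ x₂ (backExps n true) ≈ 1#
    back-pos x₁ x₂ n with isOdd (suc n)
    ... | true = solve 0 (con one :* con one :* con one :* con one :* con one := con one) refl
    ... | false = solve 0 (con one :* con one :* con one :* con one :* con one := con one) refl

    back-neg : ∀ x₁ x₂ n → mono x₁ x₂ (backExps n false) ≈ - (letterAt x₁ x₂ n * pow R y ((1 +ℕ n) / 2) * pow R z (n / 2))
    back-neg x₁ x₂ n = begin
      mono x₁ x₂ (backExps n false)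
        ≡⟨ ≡.cong₂ (λ a d → sgn R a * X₁ * X₂ * pow R y d * pow R z (n / 2 +ℕ 0))
                   (length≡ n) (ℕₚ.+-identityʳ ((1 +ℕ n) / 2)) ⟩
      sgn R (suc (n +ℕ n)) * X₁ * X₂ * Y * pow R z (n / 2 +ℕ 0)
        ≡⟨ ≡.cong (λ e → sgn R (suc (n +ℕ n)) * X₁ * X₂ * Y * pow R z e) (ℕₚ.+-identityʳ (n / 2)) ⟩
      sgn R (suc (n +ℕ n)) * X₁ * X₂ * Y * Z
        ≈⟨ *-congʳ (*-congʳ (*-congʳ (*-congʳ (sgn-odd n)))) ⟩
      - 1# * X₁ * X₂ * Y * Z
        ≈⟨ solve 4 (λ X₁ X₂ Y Z → :- con one :* X₁ :* X₂ :* Y :* Z := :- (X₁ :* X₂ :* Y :* Z)) refl X₁ X₂ Y Z ⟩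
      - (X₁ * X₂ * Y * Z)
        ≈⟨ -‿cong (*-congʳ (*-congʳ letter)) ⟩
      - (letterAt x₁ x₂ n * Y * Z) ∎
      where
      length≡ : ∀ n → n +ℕ 0 +ℕ 1 +ℕ (n +ℕ 0) ≡.≡ suc (n +ℕ n)
      length≡ = solve-∀
      X₁ X₂ Y Z : Carrier
      X₁ = pow R x₁ (count (if isOdd (suc n) then true else false))
      X₂ = pow R x₂ (count (if isOdd (suc n) then false else true))
      Y = pow R y ((1 +ℕ n) / 2)
      Z = pow R z (n / 2)
      letter : X₁ * X₂ ≈ letterAt x₁ x₂ n
      letter with isOdd (suc n)
      ... | true = solve 1 (λ X → X :* con one :* con one := X) refl x₁
      ... | false = solve 1 (λ X → con one :* (X :* con one) := X) refl x₂

    weight-exchange : ∀ {n a s} → Dominant n a s → ∀ x₁ x₂ pre u v post →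
      ∣ u ∣ ≤ n → ∣ v ∣ ≤ n → u ≢ v → does (u ℤ.<? v) ≡.≡ true →
      weight x₁ x₂ (pre ++ v ∷ a ∷ u ∷ post) ≈ - weight x₁ x₂ (pre ++ u ∷ a ∷ v ∷ post)
    weight-exchange {a = a} dom x₁ x₂ pre u v post bu bv u≢v u<v = begin
      mono x₁ x₂ (statsOf (pre ++ v ∷ a ∷ u ∷ post))
        ≡⟨ ≡.cong (mono x₁ x₂) (statsOf-exchange dom pre u v post bu bv u<v v≮u) ⟩
      mono x₁ x₂ (lengthen (statsOf (pre ++ u ∷ a ∷ v ∷ post)))
        ≈⟨ mono-lengthen x₁ x₂ (statsOf (pre ++ u ∷ a ∷ v ∷ post)) ⟩
      - weight x₁ x₂ (pre ++ u ∷ a ∷ v ∷ post) ∎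
      where
      v≮u : does (v ℤ.<? u) ≡.≡ false
      v≮u = ≡.trans (<-flip u v u≢v) (≡.cong not u<v)

    insertedWeight : Carrier → Carrier → ℤ → ℕ → List ℤ → Carrier
    insertedWeight x₁ x₂ a k σ = weight x₁ x₂ (insertAt (suc k) a σ)

    -- Exchanging the entries at positions k, k+1 of σ ∈ B n (the two
    -- neighbours of the inserted letter) maps words with a descent there to
    -- words with an ascent, reversing the sign.
    ExchangeReverses : ℤ → Carrier → Carrier → ℕ → List ℤ → Set l
    ExchangeReverses a x₁ x₂ k σ =
      (if ascentAt k (swapAt k σ) then 0# else insertedWeight x₁ x₂ a k (swapAt k σ))
      ≈ (if ascentAt k σ then - insertedWeight x₁ x₂ a k σ else 0#)

    exchange-reverses : ∀ {n a s} → Dominant n a s → ∀ x₁ x₂ pre u v post →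
      ∣ u ∣ ≤ n → ∣ v ∣ ≤ n → u ≢ v → ExchangeReverses a x₁ x₂ (length pre) (pre ++ u ∷ v ∷ post)
    exchange-reverses {a = a} dom x₁ x₂ pre u v post bu bv u≢v
      rewrite swapAt-between pre u v post | ascentAt-between pre v u post | ascentAt-between pre u v post
            | insertAt-between pre v a u post | insertAt-between pre u a v post | <-flip u v u≢v
      with does (u ℤ.<? v) in u<v
    ... | true = weight-exchange dom x₁ x₂ pre u v post bu bv u≢v u<v
    ... | false = refl

    exchange-reverses-B : ∀ {n a s} → Dominant n a s → ∀ x₁ x₂ k σ → SignedPerm n σ → suc (suc k) ≤ n →
      ExchangeReverses a x₁ x₂ k σ
    exchange-reverses-B dom x₁ x₂ k σ (len , bounded , distinct) k+2≤n
      with splitAdjacent k σ (≡.subst (suc (suc k) ≤_) (≡.sym len) k+2≤n)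
    ... | adjacentAt pre u v post ≡.refl ≡.refl =
      exchange-reverses dom x₁ x₂ pre u v post
        (proj₁ (All-adjacent pre u v post bounded)) (proj₂ (All-adjacent pre u v post bounded))
        (AllPairs-adjacent pre u v post distinct)

    interior-cancels : ∀ {n a s} → Dominant n a s → ∀ x₁ x₂ k → suc (suc k) ≤ n →
      ΣL (insertedWeight x₁ x₂ a k) (B n) ≈ 0#
    interior-cancels {n} {a} dom x₁ x₂ k k+2≤n = begin
      ΣL W (B n)                                          ≈⟨ ΣL-cong (B n) (λ σ → split (ascentAt k σ) (W σ)) ⟩
      ΣL (λ σ → ascending σ + descending σ) (B n)         ≈⟨ ΣL-+ ascending descending (B n) ⟩
      ΣL ascending (B n) + ΣL descending (B n)            ≈⟨ +-congˡ (sym (ΣL-swapAt n k descending)) ⟩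
      ΣL ascending (B n) + ΣL (λ σ → descending (swapAt k σ)) (B n)
        ≈⟨ +-congˡ (ΣL-congAll (B-signedPerm n) (λ {σ} perm → exchange-reverses-B dom x₁ x₂ k σ perm k+2≤n)) ⟩
      ΣL ascending (B n) + ΣL negated (B n)               ≈⟨ sym (ΣL-+ ascending negated (B n)) ⟩
      ΣL (λ σ → ascending σ + negated σ) (B n)            ≈⟨ ΣL-cong (B n) (λ σ → cancel (ascentAt k σ) (W σ)) ⟩
      ΣL (λ _ → 0#) (B n)                                 ≈⟨ ΣL-0 (B n) ⟩
      0#                                                  ∎
      where
      W ascending descending negated : List ℤ → Carrier
      W = insertedWeight x₁ x₂ a k
      ascending σ = if ascentAt k σ then W σ else 0#
      descending σ = if ascentAt k σ then 0# else W σ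
      negated σ = if ascentAt k σ then - W σ else 0#

      split : ∀ b w → w ≈ (if b then w else 0#) + (if b then 0# else w)
      split true w = sym (+-identityʳ w)
      split false w = sym (+-identityˡ w)

      cancel : ∀ b w → (if b then w else 0#) + (if b then - w else 0#) ≈ 0#
      cancel true w = -‿inverseʳ w
      cancel false w = +-identityʳ 0#

    yHalf zHalf : ℕ → Carrier
    yHalf n = pow R y ((1 +ℕ n) / 2)
    zHalf n = pow R z (n / 2)

    front-insertions : ∀ x₁ x₂ n σ → length σ ≡.≡ n → All (λ v → ∣ v ∣ ≤ n) σ →
      bothSigns n (weight x₁ x₂) 0 σ ≈ (sgn R n * yHalf n + sgn R (suc n) * x₁ * zHalf n) * weight x₂ x₁ σ
    front-insertions x₁ x₂ n σ len bounded = begin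
      weight x₁ x₂ (+ suc n ∷ σ) + weight x₁ x₂ (-[1+ n ] ∷ σ)
        ≈⟨ +-cong (weight-front (dominant-pos n) x₁ x₂ σ len bounded)
                  (weight-front (dominant-neg n) x₁ x₂ σ len bounded) ⟩
      mono x₁ x₂ (frontExps n true) * weight x₂ x₁ σ + mono x₁ x₂ (frontExps n false) * weight x₂ x₁ σ
        ≈⟨ sym (distribʳ _ _ _) ⟩
      (mono x₁ x₂ (frontExps n true) + mono x₁ x₂ (frontExps n false)) * weight x₂ x₁ σ
        ≈⟨ *-congʳ (+-cong (front-pos x₁ x₂ n) (front-neg x₁ x₂ n)) ⟩
      (sgn R n * yHalf n + sgn R (suc n) * x₁ * zHalf n) * weight x₂ x₁ σ ∎

    -- Inserting ±(n+1) at the end: n+1 changes nothing, -(n+1) contributes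
    -- a negative entry at position n+1 and ⌈n/2⌉ + ⌊n/2⌋ further statistics.
    back-insertions : ∀ x₁ x₂ n σ → length σ ≡.≡ n → All (λ v → ∣ v ∣ ≤ n) σ →
      bothSigns n (weight x₁ x₂) n σ ≈ (1# - letterAt x₁ x₂ n * yHalf n * zHalf n) * weight x₁ x₂ σ
    back-insertions x₁ x₂ n σ len bounded = begin
      weight x₁ x₂ (insertAt n (+ suc n) σ) + weight x₁ x₂ (insertAt n -[1+ n ] σ)
        ≡⟨ ≡.cong₂ (λ p q → weight x₁ x₂ p + weight x₁ x₂ q) (at-end (+ suc n)) (at-end -[1+ n ]) ⟩
      weight x₁ x₂ (σ ++ + suc n ∷ []) + weight x₁ x₂ (σ ++ -[1+ n ] ∷ [])
        ≈⟨ +-cong (weight-back (dominant-pos n) x₁ x₂ σ len bounded)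
                  (weight-back (dominant-neg n) x₁ x₂ σ len bounded) ⟩
      mono x₁ x₂ (backExps n true) * weight x₁ x₂ σ + mono x₁ x₂ (backExps n false) * weight x₁ x₂ σ
        ≈⟨ sym (distribʳ _ _ _) ⟩
      (mono x₁ x₂ (backExps n true) + mono x₁ x₂ (backExps n false)) * weight x₁ x₂ σ
        ≈⟨ *-congʳ (+-cong (back-pos x₁ x₂ n) (back-neg x₁ x₂ n)) ⟩
      (1# - letterAt x₁ x₂ n * yHalf n * zHalf n) * weight x₁ x₂ σ ∎
      where
      at-end : ∀ a → insertAt n a σ ≡.≡ σ ++ a ∷ []
      at-end a = ≡.trans (≡.cong (λ k → insertAt k a σ) (≡.sym len)) (insertAt-end a σ)

    interior-insertions-vanish : ∀ x₁ x₂ m → let n = suc m in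
      ΣL (λ σ → Σ< m (λ k → bothSigns n (weight x₁ x₂) (suc k) σ)) (B n) ≈ 0#
    interior-insertions-vanish x₁ x₂ m = begin
      ΣL (λ σ → Σ< m (λ k → bothSigns n W (suc k) σ)) (B n)
        ≈⟨ ΣL-Σ< m (λ σ k → bothSigns n W (suc k) σ) (B n) ⟩
      Σ< m (λ k → ΣL (bothSigns n W (suc k)) (B n))
        ≈⟨ Σ<-cong m (λ k k<m → trans (ΣL-+ _ _ (B n))
             (trans (+-cong (interior-cancels (dominant-pos n) x₁ x₂ k (s≤s k<m))
                            (interior-cancels (dominant-neg n) x₁ x₂ k (s≤s k<m)))
                    (+-identityʳ 0#))) ⟩
      Σ< m (λ _ → 0#)
        ≈⟨ Σ<-0 m ⟩
      0# ∎
      where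
      n = suc m
      W : List ℤ → Carrier
      W = weight x₁ x₂

    recurrence : ∀ x₁ x₂ m → let n = suc m in
      lhs R (suc n) x₁ x₂ y z
      ≈ (1# - letterAt x₁ x₂ n * yHalf n * zHalf n) * lhs R n x₁ x₂ y z
        + (sgn R n * yHalf n + sgn R (suc n) * x₁ * zHalf n) * lhs R n x₂ x₁ y z
    recurrence x₁ x₂ m = begin
      ΣL W (B (suc n))
        ≈⟨ ΣL-B-suc n W ⟩
      ΣL (λ σ → Σ< (suc n) (λ k → bothSigns n W k σ)) (B n)
        ≈⟨ ΣL-congAll (B-signedPerm n) (λ {σ} (len , bounded , _) → by-position σ len bounded) ⟩
      ΣL (λ σ → exchanged * W′ σ + (middle σ + kept * W σ)) (B n)
        ≈⟨ trans (ΣL-+ _ _ (B n)) (+-cong (ΣL-* exchanged W′ (B n))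
             (trans (ΣL-+ middle _ (B n)) (+-cong (interior-insertions-vanish x₁ x₂ m) (ΣL-* kept W (B n))))) ⟩
      exchanged * ΣL W′ (B n) + (0# + kept * ΣL W (B n))
        ≈⟨ trans (+-congˡ (+-identityˡ _)) (+-comm _ _) ⟩
      kept * ΣL W (B n) + exchanged * ΣL W′ (B n) ∎
      where
      n = suc m
      W W′ : List ℤ → Carrier
      W = weight x₁ x₂
      W′ = weight x₂ x₁
      kept exchanged : Carrier
      kept = 1# - letterAt x₁ x₂ n * yHalf n * zHalf n
      exchanged = sgn R n * yHalf n + sgn R (suc n) * x₁ * zHalf n

      middle : List ℤ → Carrier
      middle σ = Σ< m (λ k → bothSigns n W (suc k) σ)

      by-position : ∀ σ → length σ ≡.≡ n → All (λ v → ∣ v ∣ ≤ n) σ →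
        Σ< (suc n) (λ k → bothSigns n W k σ) ≈ exchanged * W′ σ + (middle σ + kept * W σ)
      by-position σ len bounded =
        +-cong (front-insertions x₁ x₂ n σ len bounded)
               (trans (Σ<-snoc m (λ k → bothSigns n W (suc k) σ))
                      (+-congˡ (back-insertions x₁ x₂ n σ len bounded)))

module ClosedForm {c l} (R : CommutativeRing c l) where

  open CommutativeRing R
  open IntegerCoefficients R using (solve; _:=_; con; _:+_; _:*_; :-_; _:-_; one)
  open Recurrence R
  open Parity
  open import Data.Nat using (ℕ; zero; suc; _∸_; _/_) renaming (_+_ to _+ℕ_; _*_ to _*ℕ_)
  import Data.Nat.Properties as ℕₚ
  open import Data.Bool using (true; false; not; if_then_else_)
  open import Data.Bool.Properties using (not-injective)
  open import Data.Product using (_×_; _,_; proj₁; proj₂)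
  import Relation.Binary.PropositionalEquality as ≡
  open import Level using (_⊔_)
  open import Relation.Binary.Reasoning.Setoid setoid

  prodFrom-snoc : ∀ a N f → prodFrom R a (suc N) f ≈ prodFrom R a N f * f (a +ℕ N)
  prodFrom-snoc a zero f = begin
    f a * 1#         ≈⟨ *-identityʳ (f a) ⟩
    f a              ≡⟨ ≡.cong f (≡.sym (ℕₚ.+-identityʳ a)) ⟩
    f (a +ℕ 0)       ≈⟨ sym (*-identityˡ _) ⟩
    1# * f (a +ℕ 0)  ∎
  prodFrom-snoc a (suc N) f = begin
    f a * prodFrom R (suc a) (suc N) f             ≈⟨ *-congˡ (prodFrom-snoc (suc a) N f) ⟩
    f a * (prodFrom R (suc a) N f * f (suc a +ℕ N)) ≈⟨ sym (*-assoc _ _ _) ⟩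
    f a * prodFrom R (suc a) N f * f (suc a +ℕ N)   ≡⟨ ≡.cong (λ k → f a * prodFrom R (suc a) N f * f k) (≡.sym (ℕₚ.+-suc a N)) ⟩
    f a * prodFrom R (suc a) N f * f (a +ℕ suc N)   ∎

  prodFrom-cong : ∀ a N {f g : ℕ → Carrier} → (∀ i → f i ≈ g i) → prodFrom R a N f ≈ prodFrom R a N g
  prodFrom-cong a zero h = refl
  prodFrom-cong a (suc N) h = *-cong (h a) (prodFrom-cong (suc a) N h)

  sgn-parity : ∀ n → (isOdd n ≡.≡ true → sgn R n ≈ - 1#) × (isOdd n ≡.≡ false → sgn R n ≈ 1#)
  sgn-parity zero = (λ ()) , (λ _ → refl)
  sgn-parity (suc zero) = (λ _ → *-identityʳ (- 1#)) , (λ ())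
  sgn-parity (suc (suc n)) =
    (λ odd → trans two-steps (proj₁ (sgn-parity n) (≡.trans (≡.sym (isOdd-+2 n)) odd))) ,
    (λ even → trans two-steps (proj₂ (sgn-parity n) (≡.trans (≡.sym (isOdd-+2 n)) even)))
    where
    two-steps : sgn R (suc (suc n)) ≈ sgn R n
    two-steps = solve 1 (λ S → :- con one :* (:- con one :* S) := S) refl (sgn R n)

  odd-before-even : ∀ n → isOdd (suc n) ≡.≡ false → isOdd n ≡.≡ true
  odd-before-even n h = not-injective (≡.trans (≡.sym (isOdd-suc n)) h)

  even-before-odd : ∀ n → isOdd (suc n) ≡.≡ true → isOdd n ≡.≡ false
  even-before-odd n h = not-injective (≡.trans (≡.sym (isOdd-suc n)) h)

  module _ (y z : Carrier) where

    yFactor : ℕ → Carrier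
    yFactor i = 1# + sgn R i * pow R y (suc i / 2)

    zFactor : Carrier → Carrier → ℕ → Carrier
    zFactor x₁ x₂ i = 1# - x₁ * x₂ * pow R z (2 *ℕ i)

    commonProd-sym : ∀ n x₁ x₂ → commonProd R n x₂ x₁ y z ≈ commonProd R n x₁ x₂ y z
    commonProd-sym n x₁ x₂ = *-congˡ (prodFrom-cong 0 (n / 2) (λ i → +-congˡ (-‿cong (*-congʳ (*-comm x₂ x₁)))))

    yProd-step : ∀ m → prodFrom R 1 (suc m) yFactor ≈ prodFrom R 1 m yFactor * (1# + sgn R (suc m) * yHalf y z (suc m))
    yProd-step m = prodFrom-snoc 1 m yFactor

    zProd-step-odd : ∀ n x₁ x₂ → isOdd n ≡.≡ true →
      prodFrom R 0 (suc n / 2) (zFactor x₁ x₂)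
      ≈ prodFrom R 0 (n / 2) (zFactor x₁ x₂) * (1# - x₁ * x₂ * (zHalf y z n * zHalf y z n))
    zProd-step-odd n x₁ x₂ odd = begin
      prodFrom R 0 (suc n / 2) (zFactor x₁ x₂)
        ≡⟨ ≡.cong (λ k → prodFrom R 0 k (zFactor x₁ x₂)) (half-suc-odd n odd) ⟩
      prodFrom R 0 (suc (n / 2)) (zFactor x₁ x₂)
        ≈⟨ prodFrom-snoc 0 (n / 2) (zFactor x₁ x₂) ⟩
      prodFrom R 0 (n / 2) (zFactor x₁ x₂) * zFactor x₁ x₂ (n / 2)
        ≈⟨ *-congˡ (+-congˡ (-‿cong (*-congˡ (pow-double (n / 2))))) ⟩
      prodFrom R 0 (n / 2) (zFactor x₁ x₂) * (1# - x₁ * x₂ * (zHalf y z n * zHalf y z n)) ∎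
      where
      pow-double : ∀ k → pow R z (2 *ℕ k) ≈ pow R z k * pow R z k
      pow-double k = trans (pow-+ z k (k +ℕ 0)) (*-congˡ (reflexive (≡.cong (pow R z) (ℕₚ.+-identityʳ k))))

    zProd-step-even : ∀ n x₁ x₂ → isOdd n ≡.≡ false →
      prodFrom R 0 (suc n / 2) (zFactor x₁ x₂) ≈ prodFrom R 0 (n / 2) (zFactor x₁ x₂)
    zProd-step-even n x₁ x₂ even = reflexive (≡.cong (λ k → prodFrom R 0 k (zFactor x₁ x₂)) (half-suc-even n even))

    -- The two ring identities behind the induction step (Y = y^⌈n/2⌉,
    -- Z = z^⌊n/2⌋, Q = commonProd n = P₁ P₂).
    identity-odd-to-even : ∀ x₁ x₂ Y Z P₁ P₂ →
      (1# - x₂ * Y * Z) * ((1# - x₁ * Z) * (P₁ * P₂)) + (- 1# * Y + 1# * x₁ * Z) * ((1# - x₂ * Z) * (P₁ * P₂))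
      ≈ (P₁ * (1# + - 1# * Y)) * (P₂ * (1# - x₁ * x₂ * (Z * Z)))
    identity-odd-to-even = solve 6 (λ X₁ X₂ Y Z P₁ P₂ →
      (con one :- X₂ :* Y :* Z) :* ((con one :- X₁ :* Z) :* (P₁ :* P₂))
        :+ (:- con one :* Y :+ con one :* X₁ :* Z) :* ((con one :- X₂ :* Z) :* (P₁ :* P₂))
      := (P₁ :* (con one :+ :- con one :* Y)) :* (P₂ :* (con one :- X₁ :* X₂ :* (Z :* Z)))) refl

    identity-even-to-odd : ∀ x₁ Y Z P₁ P₂ →
      (1# - x₁ * Y * Z) * (P₁ * P₂) + (1# * Y + - 1# * x₁ * Z) * (P₁ * P₂)
      ≈ (1# - x₁ * Z) * ((P₁ * (1# + 1# * Y)) * P₂)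
    identity-even-to-odd = solve 5 (λ X₁ Y Z P₁ P₂ →
      (con one :- X₁ :* Y :* Z) :* (P₁ :* P₂) :+ (con one :* Y :+ :- con one :* X₁ :* Z) :* (P₁ :* P₂)
      := (con one :- X₁ :* Z) :* ((P₁ :* (con one :+ con one :* Y)) :* P₂)) refl

    ClosedFormAt : ℕ → Set (c ⊔ l)
    ClosedFormAt n = ∀ x₁ x₂ →
      (isOdd n ≡.≡ false → lhs R n x₁ x₂ y z ≈ commonProd R n x₁ x₂ y z)
      × (isOdd n ≡.≡ true → lhs R n x₁ x₂ y z ≈ (1# - x₁ * pow R z ((n ∸ 1) / 2)) * commonProd R n x₁ x₂ y z)

    -- B 1 = {[1], [-1]} gives 1 - x₁.
    closed-form-1 : ClosedFormAt 1
    closed-form-1 x₁ x₂ = (λ ()) , (λ _ → trans (+-congˡ (+-identityʳ _)) (solve 1 (λ X₁ →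
      con one :* con one :* con one :* con one :* con one
        :+ (:- con one :* con one) :* (X₁ :* con one) :* con one :* con one :* con one
      := (con one :- X₁ :* con one) :* (con one :* con one)) refl x₁))

    step-from-odd : ∀ m x₁ x₂ → isOdd (suc m) ≡.≡ true → ClosedFormAt (suc m) →
      lhs R (2 +ℕ m) x₁ x₂ y z ≈ commonProd R (2 +ℕ m) x₁ x₂ y z
    step-from-odd m x₁ x₂ odd ih = begin
      lhs R (suc n) x₁ x₂ y z
        ≈⟨ recurrence y z x₁ x₂ m ⟩
      (1# - letterAt x₁ x₂ n * Y * Z) * lhs R n x₁ x₂ y z
        + (sgn R n * Y + sgn R (suc n) * x₁ * Z) * lhs R n x₂ x₁ y z
        ≈⟨ +-cong (*-cong (+-congˡ (-‿cong (*-congʳ (*-congʳ (reflexive letter)))))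
                          (trans (proj₂ (ih x₁ x₂) odd) (*-congʳ (+-congˡ (-‿cong (*-congˡ Z≈))))))
                  (*-cong (+-cong (*-congʳ (proj₁ (sgn-parity n) odd)) (*-congʳ (*-congʳ (proj₂ (sgn-parity (suc n)) next-even))))
                          (trans (proj₂ (ih x₂ x₁) odd) (*-cong (+-congˡ (-‿cong (*-congˡ Z≈))) (commonProd-sym n x₁ x₂)))) ⟩
      (1# - x₂ * Y * Z) * ((1# - x₁ * Z) * (P₁ * P₂)) + (- 1# * Y + 1# * x₁ * Z) * ((1# - x₂ * Z) * (P₁ * P₂))
        ≈⟨ identity-odd-to-even x₁ x₂ Y Z P₁ P₂ ⟩
      (P₁ * (1# + - 1# * Y)) * (P₂ * (1# - x₁ * x₂ * (Z * Z)))
        ≈⟨ sym (*-cong (trans (yProd-step m) (*-congˡ (+-congˡ (*-congʳ (proj₁ (sgn-parity n) odd)))))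
                       (zProd-step-odd n x₁ x₂ odd)) ⟩
      commonProd R (suc n) x₁ x₂ y z ∎
      where
      n = suc m
      Y Z P₁ P₂ : Carrier
      Y = yHalf y z n
      Z = zHalf y z n
      P₁ = prodFrom R 1 m yFactor
      P₂ = prodFrom R 0 (n / 2) (zFactor x₁ x₂)
      next-even : isOdd (suc n) ≡.≡ false
      next-even = ≡.trans (isOdd-suc n) (≡.cong not odd)
      letter : letterAt x₁ x₂ n ≡.≡ x₂
      letter = ≡.cong (λ b → if b then x₁ else x₂) next-even
      Z≈ : pow R z (m / 2) ≈ Z
      Z≈ = reflexive (≡.cong (pow R z) (≡.sym (half-suc-even m (even-before-odd m odd))))

    step-from-even : ∀ m x₁ x₂ → isOdd (suc m) ≡.≡ false → ClosedFormAt (suc m) →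
      lhs R (2 +ℕ m) x₁ x₂ y z ≈ (1# - x₁ * pow R z (suc m / 2)) * commonProd R (2 +ℕ m) x₁ x₂ y z
    step-from-even m x₁ x₂ even ih = begin
      lhs R (suc n) x₁ x₂ y z
        ≈⟨ recurrence y z x₁ x₂ m ⟩
      (1# - letterAt x₁ x₂ n * Y * Z) * lhs R n x₁ x₂ y z
        + (sgn R n * Y + sgn R (suc n) * x₁ * Z) * lhs R n x₂ x₁ y z
        ≈⟨ +-cong (*-cong (+-congˡ (-‿cong (*-congʳ (*-congʳ (reflexive letter))))) (proj₁ (ih x₁ x₂) even))
                  (*-cong (+-cong (*-congʳ (proj₂ (sgn-parity n) even)) (*-congʳ (*-congʳ (proj₁ (sgn-parity (suc n)) next-odd))))
                          (trans (proj₁ (ih x₂ x₁) even) (commonProd-sym n x₁ x₂))) ⟩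
      (1# - x₁ * Y * Z) * (P₁ * P₂) + (1# * Y + - 1# * x₁ * Z) * (P₁ * P₂)
        ≈⟨ identity-even-to-odd x₁ Y Z P₁ P₂ ⟩
      (1# - x₁ * Z) * ((P₁ * (1# + 1# * Y)) * P₂)
        ≈⟨ *-congˡ (sym (*-cong (trans (yProd-step m) (*-congˡ (+-congˡ (*-congʳ (proj₂ (sgn-parity n) even)))))
                                (zProd-step-even n x₁ x₂ even))) ⟩
      (1# - x₁ * Z) * commonProd R (suc n) x₁ x₂ y z ∎
      where
      n = suc m
      Y Z P₁ P₂ : Carrier
      Y = yHalf y z n
      Z = zHalf y z n
      P₁ = prodFrom R 1 m yFactor
      P₂ = prodFrom R 0 (n / 2) (zFactor x₁ x₂)
      next-odd : isOdd (suc n) ≡.≡ true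
      next-odd = ≡.trans (isOdd-suc n) (≡.cong not even)
      letter : letterAt x₁ x₂ n ≡.≡ x₁
      letter = ≡.cong (λ b → if b then x₁ else x₂) next-odd

    closed-form : ∀ m → ClosedFormAt (suc m)
    closed-form zero = closed-form-1
    closed-form (suc m) x₁ x₂ =
      (λ even → step-from-odd m x₁ x₂ (odd-before-even (suc m) even) (closed-form m)) ,
      (λ odd → step-from-even m x₁ x₂ (even-before-odd (suc m) odd) (closed-form m))

mainTheorem7 : {c l : Level} (R : CommutativeRing c l) (n : ℕ) → 1 ≤ n →
    (x₁ x₂ y z : CommutativeRing.Carrier R) →
      (n % 2 ≡ 0 → CommutativeRing._≈_ R (lhs R n x₁ x₂ y z) (commonProd R n x₁ x₂ y z))
      × (n % 2 ≡ 1 → CommutativeRing._≈_ R (lhs R n x₁ x₂ y z)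
           (CommutativeRing._*_ R
             (CommutativeRing._-_ R (CommutativeRing.1# R)
               (CommutativeRing._*_ R x₁ (pow R z ((n ∸ 1) / 2))))
             (commonProd R n x₁ x₂ y z)))
mainTheorem7 R (suc m) _ x₁ x₂ y z =
  (λ n-even → proj₁ (closed-form y z m x₁ x₂) (parity n-even)) ,
  (λ n-odd → proj₂ (closed-form y z m x₁ x₂) (parity n-odd))
  where
  open ClosedForm R using (closed-form)
  parity : ∀ {r} → suc m % 2 ≡ r → isOdd (suc m) ≡ does (r ≟ 1)
  parity = cong (λ r → does (r ≟ 1))
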